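{- For every integer $n\ge 0$, \[ (p_{1,5}+p_{4,5})(n) = M+\sum_{k=1}^\infty (-1)^{k+1}\big( (p_{1,5}+p_{4,5})(n-P_{7,k})+(p_{1,5}+p_{4,5})(n-Q_{7,k})\big), \] where $M=(-1)^m$ if $n=5P_{5,m}$ or $n=5Q_{5,m}$ for some integer $m\ge 0$, and $M=0$ otherwise. Here $P_{g,k}=\frac{k((g-2)k-(g-4))}{2}$ and $Q_{g,k}=\frac{k((g-2)k+(g-4))}{2}$.
   Context: $(p_{1,5}+p_{4,5})(n)$ denotes the number of partitions of $n$ in which every part is congruent to $1$ or to $4$ modulo $5$ (value $1$ at $n=0$), extended by $(p_{1,5}+p_{4,5})(x)=0$ for $x\notin\mathbb{N}_0$. -}

module Defs where

open import Data.Bool using (Bool; true; false; if_then_else_; _∨_)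
open import Data.Nat using (ℕ; zero; suc; _+_; _*_; _∸_; _≡ᵇ_; _/_; _%_)
open import Data.Integer using (ℤ; +_; -[1+_]; _-_; _^_; -1ℤ) renaming (_+_ to _+ℤ_)
open import Data.Product using (∃; _×_)
open import Data.Sum using (_⊎_)
open import Relation.Binary.PropositionalEquality using (_≡_; _≢_)

allowed : ℕ → Bool
allowed d = (d % 5 ≡ᵇ 1) ∨ (d % 5 ≡ᵇ 4)

sumTo : ℕ → (ℕ → ℕ) → ℕ
sumTo zero f = f 0
sumTo (suc J) f = sumTo J f + f (suc J)

-- countUpTo m n = number of partitions of n all of whose parts are
-- allowed and ≤ m  (recursion on the largest admissible part size m,
-- choosing its multiplicity j).
countUpTo : ℕ → ℕ → ℕ
countUpTo zero n = if n ≡ᵇ 0 then 1 else 0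
countUpTo (suc m) n =
  if allowed (suc m)
  then sumTo (n / suc m) (λ j → countUpTo m (n ∸ j * suc m))
  else countUpTo m n

p14 : ℕ → ℕ
p14 n = countUpTo n n

p14ℤ : ℤ → ℤ
p14ℤ (+ n) = + p14 n
p14ℤ -[1+ n ] = + 0

-- polygonal-type numbers P_{g,k} = k((g-2)k-(g-4))/2, Q_{g,k} = k((g-2)k+(g-4))/2
-- (exact natural numbers for g ≥ 4, k ≥ 0)
P : ℕ → ℕ → ℕ
P g k = (k * ((g ∸ 2) * k ∸ (g ∸ 4))) / 2

Q : ℕ → ℕ → ℕ
Q g k = (k * ((g ∸ 2) * k + (g ∸ 4))) / 2

sumℤ1 : ℕ → (ℕ → ℤ) → ℤ
sumℤ1 zero f = + 0
sumℤ1 (suc K) f = sumℤ1 K f +ℤ f (suc K)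

term : ℕ → ℕ → ℤ
term n k = (-1ℤ ^ (k + 1)) Data.Integer.* (p14ℤ (+ n - + P 7 k) +ℤ p14ℤ (+ n - + Q 7 k))

IsM : ℕ → ℤ → Set
IsM n M =
  (∃ λ m → (n ≡ 5 * P 5 m ⊎ n ≡ 5 * Q 5 m) × M ≡ -1ℤ ^ m)
  ⊎ ((∀ m → n ≢ 5 * P 5 m × n ≢ 5 * Q 5 m) × M ≡ + 0)

-- The generating function of p_{1,5}+p_{4,5} is 1 / ∏ (1 - q^j) over j ≡ ±1 (mod 5).  Jacobi's
-- triple product in base q^5 gives
--   (q^5;q^5)_∞ ∏_{k≥0} (1 - q^(5k+1)) (1 - q^(5k+4)) = Σ_{k≥0} (-1)^k (q^P_{7,k} + q^Q_{7,k})
-- (the k = 0 term counted once), and in base q^15 it gives Euler's pentagonal theorem in q^5: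
--   (q^5;q^5)_∞ = Σ_{m≥0} (-1)^m (q^(5 P_{5,m}) + q^(5 Q_{5,m})).
-- Multiplying the first identity by the generating function and comparing with the second gives the
-- claim coefficientwise.  Series are coefficient sequences compared modulo q^m, and the triple product
-- comes from its finite form
--   ∏_{k<n} (1 - q^(Ak+B)) (1 - q^(Ak+B′)) = Σ_{i≤2n} (-1)^(n+i) q^E(n,i) [2n, i]_{q^A}:
-- after multiplication by (q^A;q^A)_n each summand agrees with (-1)^(n+i) q^E(n,i) below q^(n+1).

module Submission where

open import Defs
open import Data.Nat using (ℕ; _≤_)
open import Data.Integer using (ℤ; +_) renaming (_+_ to _+ℤ_)
open import Relation.Binary.PropositionalEquality using (_≡_)

open import Data.Bool using (Bool; true; false; if_then_else_; _∨_)
open import Data.Nat using (zero; suc; _<_; z≤n; s≤s; _/_; _≡ᵇ_; >-nonZero)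
  renaming (_+_ to _+ₙ_; _*_ to _*ₙ_; _∸_ to _∸ₙ_)
import Data.Nat.Properties as ℕP
import Data.Nat.DivMod as ℕDM
import Data.Nat.Tactic.RingSolver as ℕSolver
open import Data.Integer using (_+_; _-_; -_; _*_; -1ℤ) renaming (_^_ to _^ℤ_)
import Data.Integer.Properties as ℤP
open import Data.Integer.Tactic.RingSolver using (solve-∀)
open import Relation.Binary.PropositionalEquality
  using (_≢_; _≗_; refl; sym; trans; cong; cong₂; subst; _→-setoid_; module ≡-Reasoning)
open import Relation.Binary using (Setoid; tri<; tri≈; tri>)
import Relation.Binary.Reasoning.Setoid as SetoidReasoning
open import Data.Empty using (⊥-elim)
open import Data.Product using (∃; _,_; _×_; proj₁; proj₂)
open import Data.Sum using (_⊎_; inj₁; inj₂)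
open import Data.Nat.Induction using (<-rec)

Series : Set
Series = ℕ → ℤ

0ₛ 1ₛ : Series
0ₛ _ = + 0
1ₛ zero = + 1
1ₛ (suc _) = + 0

infixl 6 _⊕_ _⊖_
infixr 7 _⊙_

_⊕_ _⊖_ : Series → Series → Series
(f ⊕ g) N = f N + g N
(f ⊖ g) N = f N - g N

negate : Series → Series
negate f N = - f N

_⊙_ : ℤ → Series → Series
(c ⊙ f) N = c * f N

shift : ℕ → Series → Series
shift zero f = f
shift (suc s) f zero = + 0
shift (suc s) f (suc N) = shift s f N

factor : ℕ → Series → Series
factor s f = f ⊖ shift s f

infix 4 _≈[_]_

_≈[_]_ : Series → ℕ → Series → Set
f ≈[ m ] g = ∀ N → N < m → f N ≡ g N

≗-sym : {f g : Series} → f ≗ g → g ≗ f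
≗-sym p N = sym (p N)

≗-trans : {f g h : Series} → f ≗ g → g ≗ h → f ≗ h
≗-trans p q N = trans (p N) (q N)

≈-refl : ∀ {m f} → f ≈[ m ] f
≈-refl _ _ = refl

≈-sym : ∀ {m f g} → f ≈[ m ] g → g ≈[ m ] f
≈-sym p N l = sym (p N l)

≈-trans : ∀ {m f g h} → f ≈[ m ] g → g ≈[ m ] h → f ≈[ m ] h
≈-trans p q N l = trans (p N l) (q N l)

≈-weaken : ∀ {m m′ f g} → m′ ≤ m → f ≈[ m ] g → f ≈[ m′ ] g
≈-weaken le p N l = p N (ℕP.<-≤-trans l le)

≗⇒≈ : ∀ {m f g} → f ≗ g → f ≈[ m ] g
≗⇒≈ p N _ = p N

≈-setoid : ℕ → Setoid _ _
≈-setoid m = record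
  { Carrier = Series
  ; _≈_ = _≈[ m ]_
  ; isEquivalence = record { refl = ≈-refl ; sym = ≈-sym ; trans = ≈-trans }
  }

split≤ : ∀ {m n} → m ≤ n → ∃ λ k → n ≡ m +ₙ k
split≤ le = let (k , e) = ℕP.m≤n⇒∃[o]m+o≡n le in k , sym e

half-≡ : ∀ {t u} → t ≡ u *ₙ 2 → t / 2 ≡ u
half-≡ {u = u} refl = ℕDM.m*n/n≡m u 2

<⊎+ : ∀ s N → N < s ⊎ ∃ λ N′ → N ≡ s +ₙ N′
<⊎+ s N with ℕP.<-≤-connex N s
... | inj₁ N<s = inj₁ N<s
... | inj₂ s≤N = inj₂ (split≤ s≤N)

shift-cong : ∀ s {f g} → f ≗ g → shift s f ≗ shift s g
shift-cong zero p N = p N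
shift-cong (suc s) p zero = refl
shift-cong (suc s) p (suc N) = shift-cong s p N

shift-⊕ : ∀ s f g → shift s (f ⊕ g) ≗ shift s f ⊕ shift s g
shift-⊕ zero f g N = refl
shift-⊕ (suc s) f g zero = refl
shift-⊕ (suc s) f g (suc N) = shift-⊕ s f g N

shift-⊖ : ∀ s f g → shift s (f ⊖ g) ≗ shift s f ⊖ shift s g
shift-⊖ zero f g N = refl
shift-⊖ (suc s) f g zero = refl
shift-⊖ (suc s) f g (suc N) = shift-⊖ s f g N

shift-⊙ : ∀ s c f → shift s (c ⊙ f) ≗ c ⊙ shift s f
shift-⊙ zero c f N = refl
shift-⊙ (suc s) c f zero = sym (ℤP.*-zeroʳ c)
shift-⊙ (suc s) c f (suc N) = shift-⊙ s c f N

shift-0ₛ : ∀ s → shift s 0ₛ ≗ 0ₛ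
shift-0ₛ zero N = refl
shift-0ₛ (suc s) zero = refl
shift-0ₛ (suc s) (suc N) = shift-0ₛ s N

shift-shift : ∀ a b f → shift a (shift b f) ≗ shift (a +ₙ b) f
shift-shift zero b f N = refl
shift-shift (suc a) b f zero = refl
shift-shift (suc a) b f (suc N) = shift-shift a b f N

shift-≡ : ∀ {a b} f → a ≡ b → shift a f ≗ shift b f
shift-≡ f refl N = refl

shift-below : ∀ s f N → N < s → shift s f N ≡ + 0
shift-below (suc s) f zero l = refl
shift-below (suc s) f (suc N) (s≤s l) = shift-below s f N l

shift-+ : ∀ s f N → shift s f (s +ₙ N) ≡ f N
shift-+ zero f N = refl
shift-+ (suc s) f N = shift-+ s f N

shift-≈-+ : ∀ s m {f g} → f ≈[ m ] g → shift s f ≈[ s +ₙ m ] shift s g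
shift-≈-+ zero m p N l = p N l
shift-≈-+ (suc s) m p zero l = refl
shift-≈-+ (suc s) m p (suc N) (s≤s l) = shift-≈-+ s m p N l

shift-≈ : ∀ s m {f g} → f ≈[ m ] g → shift s f ≈[ m ] shift s g
shift-≈ s m {f} {g} p N l with <⊎+ s N
... | inj₁ N<s = trans (shift-below s f N N<s) (sym (shift-below s g N N<s))
... | inj₂ (N′ , refl) =
  trans (shift-+ s f N′) (trans (p N′ (ℕP.≤-<-trans (ℕP.m≤n+m N′ s) l)) (sym (shift-+ s g N′)))

factor-≈ : ∀ s f → factor s f ≈[ s ] f
factor-≈ s f N l rewrite shift-below s f N l = ℤP.+-identityʳ (f N)

-- The operators f ↦ g f for a fixed power series g.
record IsMultiplier (T : Series → Series) : Set where
  field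
    ≗-cong : ∀ {f g} → f ≗ g → T f ≗ T g
    ⊕-homo : ∀ f g → T (f ⊕ g) ≗ T f ⊕ T g
    ⊖-homo : ∀ f g → T (f ⊖ g) ≗ T f ⊖ T g
    ⊙-homo : ∀ c f → T (c ⊙ f) ≗ c ⊙ T f
    shift-homo : ∀ s f → T (shift s f) ≗ shift s (T f)
    ≈-cong : ∀ m {f g} → f ≈[ m ] g → T f ≈[ m ] T g
open IsMultiplier public

id-isMultiplier : IsMultiplier (λ f → f)
id-isMultiplier = record
  { ≗-cong = λ p → p ; ⊕-homo = λ _ _ _ → refl ; ⊖-homo = λ _ _ _ → refl ; ⊙-homo = λ _ _ _ → refl
  ; shift-homo = λ _ _ _ → refl ; ≈-cong = λ _ p → p }

∘-isMultiplier : ∀ {T U} → IsMultiplier T → IsMultiplier U → IsMultiplier (λ f → T (U f))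
∘-isMultiplier {T} {U} mT mU = record
  { ≗-cong = λ p → ≗-cong mT (≗-cong mU p)
  ; ⊕-homo = λ f g → ≗-trans (≗-cong mT (⊕-homo mU f g)) (⊕-homo mT (U f) (U g))
  ; ⊖-homo = λ f g → ≗-trans (≗-cong mT (⊖-homo mU f g)) (⊖-homo mT (U f) (U g))
  ; ⊙-homo = λ c f → ≗-trans (≗-cong mT (⊙-homo mU c f)) (⊙-homo mT c (U f))
  ; shift-homo = λ s f → ≗-trans (≗-cong mT (shift-homo mU s f)) (shift-homo mT s (U f))
  ; ≈-cong = λ m p → ≈-cong mT m (≈-cong mU m p) }

shift-isMultiplier : ∀ s → IsMultiplier (shift s)
shift-isMultiplier s = record
  { ≗-cong = shift-cong s
  ; ⊕-homo = shift-⊕ s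
  ; ⊖-homo = shift-⊖ s
  ; ⊙-homo = shift-⊙ s
  ; shift-homo = λ t f N →
      trans (shift-shift s t f N) (trans (shift-≡ f (ℕP.+-comm s t) N) (sym (shift-shift t s f N)))
  ; ≈-cong = λ m → shift-≈ s m }

factor-isMultiplier : ∀ s → IsMultiplier (factor s)
factor-isMultiplier s = record
  { ≗-cong = λ p N → cong₂ _-_ (p N) (shift-cong s p N)
  ; ⊕-homo = λ f g N → trans (cong (λ t → (f N + g N) - t) (shift-⊕ s f g N)) (+-minus-+ (f N) (g N) _ _)
  ; ⊖-homo = λ f g N → trans (cong (λ t → (f N - g N) - t) (shift-⊖ s f g N)) (minus-minus (f N) (g N) _ _)
  ; ⊙-homo = λ c f N → trans (cong (λ t → c * f N - t) (shift-⊙ s c f N)) (*-minus-* c (f N) _)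
  ; shift-homo = λ t f N →
      trans (cong (λ u → shift t f N - u) (shift-homo (shift-isMultiplier s) t f N)) (sym (shift-⊖ t f (shift s f) N))
  ; ≈-cong = λ m p N l → cong₂ _-_ (p N l) (shift-≈ s m p N l) }
  where
  +-minus-+ : ∀ (a b c d : ℤ) → (a + b) - (c + d) ≡ (a - c) + (b - d)
  +-minus-+ = solve-∀
  minus-minus : ∀ (a b c d : ℤ) → (a - b) - (c - d) ≡ (a - c) - (b - d)
  minus-minus = solve-∀
  *-minus-* : ∀ (x a b : ℤ) → x * a - x * b ≡ x * (a - b)
  *-minus-* = solve-∀

multiplier-0ₛ : ∀ {T} → IsMultiplier T → T 0ₛ ≗ 0ₛ
multiplier-0ₛ {T} mT N =
  trans (≗-cong mT (λ _ → sym (ℤP.+-inverseʳ (+ 0))) N) (trans (⊖-homo mT 0ₛ 0ₛ N) (ℤP.+-inverseʳ (T 0ₛ N)))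

factor-comm : ∀ {T} → IsMultiplier T → ∀ s f → factor s (T f) ≗ T (factor s f)
factor-comm {T} mT s f N = sym (trans (⊖-homo mT f (shift s f) N) (cong (λ t → T f N - t) (shift-homo mT s f N)))

factor-0 : ∀ f → factor 0 f ≗ 0ₛ
factor-0 f N = ℤP.+-inverseʳ (f N)

-- For s > 0 the coefficient N of (1 - q^s) f is f N minus an earlier coefficient.
factor-cancel : ∀ s m f → 0 < s → factor s f ≈[ m ] 0ₛ → f ≈[ m ] 0ₛ
factor-cancel s m f s>0 h = <-rec (λ N → N < m → f N ≡ + 0) step
  where
  step : ∀ N → (∀ {K} → K < N → K < m → f K ≡ + 0) → N < m → f N ≡ + 0
  step N ih N<m = trans (ℤP.i-j≡0⇒i≡j _ _ (h N N<m)) earlier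
    where
    earlier : shift s f N ≡ + 0
    earlier with <⊎+ s N
    ... | inj₁ N<s = shift-below s f N N<s
    ... | inj₂ (K , refl) = trans (shift-+ s f K) (ih K<N (ℕP.<-trans K<N N<m))
      where
      K<N : K < s +ₙ K
      K<N = ℕP.m<n+m K s>0

shift-factor : ∀ a c X → shift a (factor c X) ≗ shift a X ⊖ shift (a +ₙ c) X
shift-factor a c X N = trans (shift-⊖ a X (shift c X) N) (cong (λ t → shift a X N - t) (shift-shift a c X N))

factor-+ : ∀ a c X → factor a X ⊕ shift a (factor c X) ≗ factor (a +ₙ c) X
factor-+ a c X N = trans (cong (λ t → factor a X N + t) (shift-factor a c X N)) (telescope (X N) _ _)
  where
  telescope : ∀ (x y z : ℤ) → (x - y) + (y - z) ≡ x - z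
  telescope = solve-∀

factor-⊕-shift : ∀ a c X Y → factor a Y ≗ factor c X → factor a (X ⊕ shift a Y) ≗ factor (a +ₙ c) X
factor-⊕-shift a c X Y h N =
  trans (⊕-homo (factor-isMultiplier a) X (shift a Y) N)
    (trans (cong (λ t → factor a X N + t) (trans (shift-homo (factor-isMultiplier a) a Y N) (shift-cong a h N)))
      (factor-+ a c X N))

factor-⊕-shift′ : ∀ b d X Z → factor d Z ≗ factor b X → factor d (Z ⊕ shift b X) ≗ factor (b +ₙ d) X
factor-⊕-shift′ b d X Z h N =
  trans (⊕-homo (factor-isMultiplier d) Z (shift b X) N)
    (trans (cong₂ _+_ (h N) (shift-homo (factor-isMultiplier d) b X N)) (factor-+ b d X N))

factor-0ₛ : ∀ s → factor s 0ₛ ≗ 0ₛ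
factor-0ₛ s = multiplier-0ₛ (factor-isMultiplier s)

-- poch n f = (q^A; q^A)_n f and binom M r f = [M, r]_{q^A} f.
module GaussianBinomial (A : ℕ) where

  poch : ℕ → Series → Series
  poch zero f = f
  poch (suc n) f = factor (A *ₙ suc n) (poch n f)

  poch-isMultiplier : ∀ n → IsMultiplier (poch n)
  poch-isMultiplier zero = id-isMultiplier
  poch-isMultiplier (suc n) = ∘-isMultiplier (factor-isMultiplier (A *ₙ suc n)) (poch-isMultiplier n)

  binom : ℕ → ℕ → Series → Series
  binom M zero f = f
  binom zero (suc r) f = 0ₛ
  binom (suc M) (suc r) f = binom M r f ⊕ shift (A *ₙ suc r) (binom M (suc r) f)

  binom-vanish : ∀ M r f → M < r → binom M r f ≗ 0ₛ
  binom-vanish zero (suc r) f _ N = refl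
  binom-vanish (suc M) (suc r) f (s≤s M<r) N =
    cong₂ _+_ (binom-vanish M r f M<r N)
      (trans (shift-cong (A *ₙ suc r) (binom-vanish M (suc r) f (ℕP.m≤n⇒m≤1+n M<r)) N) (shift-0ₛ (A *ₙ suc r) N))

  binom-ratio : ∀ N j f → factor (A *ₙ suc j) (binom N (suc j) f) ≗ factor (A *ₙ (N ∸ₙ j)) (binom N j f)
  binom-ratio zero zero f =
    ≗-trans (factor-0ₛ (A *ₙ 1)) (≗-sym (≗-trans (λ N → cong (λ s → factor s f N) (ℕP.*-zeroʳ A)) (factor-0 f)))
  binom-ratio zero (suc j) f = ≗-trans (factor-0ₛ (A *ₙ suc (suc j))) (≗-sym (factor-0ₛ (A *ₙ 0)))
  binom-ratio (suc N) zero f =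
    ≗-trans (factor-⊕-shift (A *ₙ 1) (A *ₙ N) f (binom N 1 f) (binom-ratio N zero f))
      (λ K → cong (λ s → factor s f K) (exponents A N))
    where
    exponents : ∀ A N → A *ₙ 1 +ₙ A *ₙ N ≡ A *ₙ suc N
    exponents = ℕSolver.solve-∀
  binom-ratio (suc N) (suc j) f with ℕP.<-≤-connex j N
  ... | inj₁ j<N =
    ≗-trans (factor-⊕-shift (A *ₙ suc (suc j)) (A *ₙ (N ∸ₙ suc j)) X (binom N (suc (suc j)) f) (binom-ratio N (suc j) f))
      (≗-trans (λ K → cong (λ s → factor s X K) (exponents j<N))
        (≗-sym (factor-⊕-shift′ (A *ₙ suc j) (A *ₙ (N ∸ₙ j)) X (binom N j f) (≗-sym (binom-ratio N j f)))))
    where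
    X = binom N (suc j) f
    exponents : j < N → A *ₙ suc (suc j) +ₙ A *ₙ (N ∸ₙ suc j) ≡ A *ₙ suc j +ₙ A *ₙ (N ∸ₙ j)
    exponents j<N with split≤ j<N
    ... | (k , refl) rewrite ℕP.m+n∸m≡n (suc j) k | ℕP.+-∸-assoc 1 (ℕP.m≤m+n j k) | ℕP.m+n∸m≡n j k = lemma A j k
      where
      lemma : ∀ A j k → A *ₙ suc (suc j) +ₙ A *ₙ k ≡ A *ₙ suc j +ₙ A *ₙ suc k
      lemma = ℕSolver.solve-∀
  ... | inj₂ N≤j =
    ≗-trans (≗-trans (factor-isMultiplier a .≗-cong (binom-vanish (suc N) (suc (suc j)) f (s≤s (s≤s N≤j))))
                     (factor-0ₛ a))
      (≗-sym (≗-trans (λ K → cong (λ s → factor s X K) A*0) (factor-0 X)))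
    where
    a = A *ₙ suc (suc j)
    X = binom (suc N) (suc j) f
    A*0 : A *ₙ (N ∸ₙ j) ≡ 0
    A*0 = trans (cong (A *ₙ_) (ℕP.m≤n⇒m∸n≡0 N≤j)) (ℕP.*-zeroʳ A)

  binom-pascal′ : ∀ N j f → binom (suc N) (suc j) f ≗ shift (A *ₙ (N ∸ₙ j)) (binom N j f) ⊕ binom N (suc j) f
  binom-pascal′ N j f K =
    swap (binom N (suc j) f K) (shift (A *ₙ suc j) (binom N (suc j) f) K) (binom N j f K)
      (shift (A *ₙ (N ∸ₙ j)) (binom N j f) K) (binom-ratio N j f K)
    where
    swap : ∀ (x y z w : ℤ) → x - y ≡ z - w → z + y ≡ w + x
    swap x y z w h = trans (split x y z w) (trans (cong (_+ (y + w)) (sym h)) (merge x y z w))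
      where
      split : ∀ (x y z w : ℤ) → z + y ≡ (z - w) + (y + w)
      split = solve-∀
      merge : ∀ (x y z w : ℤ) → (x - y) + (y + w) ≡ w + x
      merge = solve-∀

  binom-pascal₂ : ∀ M i f → binom (suc (suc M)) (suc (suc i)) f ≗
    binom M (suc i) f ⊕ shift (A *ₙ suc M) (binom M (suc i) f) ⊕ shift (A *ₙ (M ∸ₙ i)) (binom M i f)
      ⊕ shift (A *ₙ suc (suc i)) (binom M (suc (suc i)) f)
  binom-pascal₂ M i f K =
    trans (cong₂ _+_ (binom-pascal′ M i f K)
                     (trans (shift-cong a (binom-pascal′ M (suc i) f) K) (shift-⊕ a (shift c X) Y K)))
      (trans (cong (λ t → shift d Z K + X K + (t + shift a Y K)) (trans (shift-shift a c X K) outer))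
        (reorder (shift d Z K) (X K) (shift e X K) (shift a Y K)))
    where
    X = binom M (suc i) f
    Y = binom M (suc (suc i)) f
    Z = binom M i f
    a = A *ₙ suc (suc i)
    c = A *ₙ (M ∸ₙ suc i)
    d = A *ₙ (M ∸ₙ i)
    e = A *ₙ suc M
    outer : shift (a +ₙ c) X K ≡ shift e X K
    outer with ℕP.<-≤-connex i M
    ... | inj₁ i<M = shift-≡ X (exponent i<M) K
      where
      exponent : i < M → a +ₙ c ≡ e
      exponent i<M with split≤ i<M
      ... | (k , refl) rewrite ℕP.m+n∸m≡n (suc i) k = lemma A i k
        where
        lemma : ∀ A i k → A *ₙ suc (suc i) +ₙ A *ₙ k ≡ A *ₙ suc (suc i +ₙ k)
        lemma = ℕSolver.solve-∀
    ... | inj₂ M≤i = trans (vanishes (a +ₙ c)) (sym (vanishes e))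
      where
      vanishes : ∀ s → shift s X K ≡ + 0
      vanishes s = trans (shift-cong s (binom-vanish M (suc i) f (s≤s M≤i)) K) (shift-0ₛ s K)
    reorder : ∀ (z x x′ y : ℤ) → z + x + (x′ + y) ≡ x + x′ + z + y
    reorder = solve-∀

  binom-pascal₂-1 : ∀ M f → binom (suc (suc M)) 1 f ≗ f ⊕ shift (A *ₙ suc M) f ⊕ shift (A *ₙ 1) (binom M 1 f)
  binom-pascal₂-1 M f K =
    trans (cong (λ t → f K + t) (trans (shift-cong a (binom-pascal′ M 0 f) K) (shift-⊕ a (shift (A *ₙ M) f) X K)))
      (trans (cong (λ t → f K + (t + shift a X K)) (trans (shift-shift a (A *ₙ M) f K) (shift-≡ f (exponent A M) K)))
        (sym (ℤP.+-assoc (f K) _ _)))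
    where
    X = binom M 1 f
    a = A *ₙ 1
    exponent : ∀ A M → A *ₙ 1 +ₙ A *ₙ M ≡ A *ₙ suc M
    exponent = ℕSolver.solve-∀

  poch-binom : ∀ r k f → poch r (poch k (binom (r +ₙ k) r f)) ≗ poch (r +ₙ k) f
  poch-binom-above : ∀ r k f → poch (suc r) (poch k (binom (r +ₙ k) (suc r) f)) ≗ factor (A *ₙ k) (poch (r +ₙ k) f)

  poch-binom zero k f _ = refl
  poch-binom (suc r) k f =
    ≗-trans (⊕-homo T-isMultiplier (binom (r +ₙ k) r f) (shift a (binom (r +ₙ k) (suc r) f)))
      (≗-trans (λ N → cong₂ _+_ (factor-isMultiplier a .≗-cong (poch-binom r k f) N)
                                (trans (shift-homo T-isMultiplier a _ N) (shift-cong a (poch-binom-above r k f) N)))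
        (≗-trans (factor-+ a (A *ₙ k) g) (λ N → cong (λ s → factor s g N) (exponent A r k))))
    where
    a = A *ₙ suc r
    g = poch (r +ₙ k) f
    T-isMultiplier : IsMultiplier (λ h → poch (suc r) (poch k h))
    T-isMultiplier = ∘-isMultiplier (poch-isMultiplier (suc r)) (poch-isMultiplier k)
    exponent : ∀ A r k → A *ₙ suc r +ₙ A *ₙ k ≡ A *ₙ suc (r +ₙ k)
    exponent = ℕSolver.solve-∀

  poch-binom-above r zero f =
    ≗-trans (≗-cong (poch-isMultiplier (suc r)) (binom-vanish (r +ₙ 0) (suc r) f r+0<1+r))
      (≗-trans (multiplier-0ₛ (poch-isMultiplier (suc r)))
        (≗-sym (≗-trans (λ N → cong (λ s → factor s (poch (r +ₙ 0) f) N) (ℕP.*-zeroʳ A)) (factor-0 (poch (r +ₙ 0) f)))))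
    where
    r+0<1+r : r +ₙ 0 < suc r
    r+0<1+r = s≤s (ℕP.≤-reflexive (ℕP.+-identityʳ r))
  poch-binom-above r (suc k) f =
    ≗-trans (≗-sym (factor-comm (poch-isMultiplier (suc r)) b (poch k (binom (r +ₙ suc k) (suc r) f))))
      (≗-cong (factor-isMultiplier b) shifted)
    where
    b = A *ₙ suc k
    shifted : poch (suc r) (poch k (binom (r +ₙ suc k) (suc r) f)) ≗ poch (r +ₙ suc k) f
    shifted rewrite ℕP.+-suc r k = poch-binom (suc r) k f

  poch-≈ : ∀ a b g → a ≤ b → poch b g ≈[ A *ₙ suc a ] poch a g
  poch-≈ .zero zero g z≤n = ≈-refl
  poch-≈ a (suc b) g a≤1+b with ℕP.m≤n⇒m<n∨m≡n a≤1+b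
  ... | inj₂ refl = ≈-refl
  ... | inj₁ (s≤s a≤b) =
    ≈-trans (≈-weaken (ℕP.*-monoʳ-≤ A (s≤s a≤b)) (factor-≈ (A *ₙ suc b) (poch b g))) (poch-≈ a b g a≤b)

  poch-cancel : 0 < A → ∀ n m f → poch n f ≈[ m ] 0ₛ → f ≈[ m ] 0ₛ
  poch-cancel A>0 zero m f h = h
  poch-cancel A>0 (suc n) m f h = poch-cancel A>0 n m f (factor-cancel (A *ₙ suc n) m (poch n f) A*[1+n]>0 h)
    where
    A*[1+n]>0 : 0 < A *ₙ suc n
    A*[1+n]>0 = ℕP.*-mono-≤ A>0 (s≤s z≤n)

sumℤ : ℕ → (ℕ → ℤ) → ℤ
sumℤ zero h = h 0
sumℤ (suc J) h = sumℤ J h + h (suc J)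

sumₛ : ℕ → (ℕ → Series) → Series
sumₛ J g N = sumℤ J (λ i → g i N)

sumℤ-cong : ∀ J {h k} → (∀ i → i ≤ J → h i ≡ k i) → sumℤ J h ≡ sumℤ J k
sumℤ-cong zero p = p 0 z≤n
sumℤ-cong (suc J) p = cong₂ _+_ (sumℤ-cong J (λ i l → p i (ℕP.m≤n⇒m≤1+n l))) (p (suc J) ℕP.≤-refl)

sumℤ-+ : ∀ J h k → sumℤ J (λ i → h i + k i) ≡ sumℤ J h + sumℤ J k
sumℤ-+ zero h k = refl
sumℤ-+ (suc J) h k = trans (cong (_+ (h (suc J) + k (suc J))) (sumℤ-+ J h k))
    (interchange (sumℤ J h) (sumℤ J k) (h (suc J)) (k (suc J)))
  where
  interchange : ∀ (a b c d : ℤ) → a + b + (c + d) ≡ a + c + (b + d)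
  interchange = solve-∀

sumℤ-- : ∀ J h k → sumℤ J (λ i → h i - k i) ≡ sumℤ J h - sumℤ J k
sumℤ-- zero h k = refl
sumℤ-- (suc J) h k = trans (cong (_+ (h (suc J) - k (suc J))) (sumℤ-- J h k))
    (interchange (sumℤ J h) (sumℤ J k) (h (suc J)) (k (suc J)))
  where
  interchange : ∀ (a b c d : ℤ) → a - b + (c - d) ≡ a + c - (b + d)
  interchange = solve-∀

sumℤ-unroll : ∀ J h → sumℤ (suc J) h ≡ h 0 + sumℤ J (λ i → h (suc i))
sumℤ-unroll zero h = refl
sumℤ-unroll (suc J) h = trans (cong (_+ h (suc (suc J))) (sumℤ-unroll J h)) (ℤP.+-assoc (h 0) _ _)

sumℤ-dropHead : ∀ J h → h 0 ≡ + 0 → sumℤ (suc J) h ≡ sumℤ J (λ i → h (suc i))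
sumℤ-dropHead J h h0≡0 = trans (sumℤ-unroll J h) (trans (cong (_+ rest) h0≡0) (ℤP.+-identityˡ rest))
  where
  rest = sumℤ J (λ i → h (suc i))

sumℤ-zero : ∀ J h → (∀ i → i ≤ J → h i ≡ + 0) → sumℤ J h ≡ + 0
sumℤ-zero zero h p = p 0 z≤n
sumℤ-zero (suc J) h p = cong₂ _+_ (sumℤ-zero J h (λ i l → p i (ℕP.m≤n⇒m≤1+n l))) (p (suc J) ℕP.≤-refl)

sumℤ-single : ∀ J m h → m ≤ J → (∀ i → i ≢ m → h i ≡ + 0) → sumℤ J h ≡ h m
sumℤ-single zero .zero h z≤n _ = refl
sumℤ-single (suc J) m h m≤1+J others with ℕP.m≤n⇒m<n∨m≡n m≤1+J
... | inj₁ (s≤s m≤J) =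
  trans (cong₂ _+_ (sumℤ-single J m h m≤J others) (others (suc J) (λ e → ℕP.<⇒≢ (s≤s m≤J) (sym e))))
    (ℤP.+-identityʳ (h m))
... | inj₂ refl =
  trans (cong (_+ h (suc J)) (sumℤ-zero J h (λ i i≤J → others i (λ e → ℕP.<⇒≢ (s≤s i≤J) e))))
    (ℤP.+-identityˡ (h (suc J)))

multiplier-sumₛ : ∀ {T} → IsMultiplier T → ∀ J g → T (sumₛ J g) ≗ sumₛ J (λ i → T (g i))
multiplier-sumₛ mT zero g N = refl
multiplier-sumₛ {T} mT (suc J) g N =
  trans (⊕-homo mT (sumₛ J g) (g (suc J)) N) (cong (_+ T (g (suc J)) N) (multiplier-sumₛ mT J g N))

double : ℕ → ℕ
double zero = zero
double (suc n) = suc (suc (double n))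

double≡+ : ∀ n → double n ≡ n +ₙ n
double≡+ zero = refl
double≡+ (suc n) = cong suc (trans (cong suc (double≡+ n)) (sym (ℕP.+-suc n n)))

alt : ℕ → ℤ
alt zero = + 1
alt (suc k) = - alt k

alt-+-suc : ∀ n i → alt (n +ₙ suc i) ≡ - alt (n +ₙ i)
alt-+-suc n i = cong alt (ℕP.+-suc n i)

alt-+-double : ∀ a b → alt (a +ₙ double b) ≡ alt a
alt-+-double a zero = cong alt (ℕP.+-identityʳ a)
alt-+-double a (suc b) =
  trans (cong alt (trans (ℕP.+-suc a (suc (double b))) (cong suc (ℕP.+-suc a (double b)))))
    (trans (ℤP.neg-involutive _) (alt-+-double a b))

≤⊎> : ∀ n i → (∃ λ d → i ≡ n +ₙ d) ⊎ (∃ λ d → n ≡ suc i +ₙ d)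
≤⊎> zero i = inj₁ (i , refl)
≤⊎> (suc n) zero = inj₂ (n , refl)
≤⊎> (suc n) (suc i) with ≤⊎> n i
... | inj₁ (d , e) = inj₁ (d , cong suc e)
... | inj₂ (d , e) = inj₂ (d , cong suc e)

-- Finite form of Jacobi's triple product in base q^A, A = B + B′.
module TripleProduct (B B′ : ℕ) where

  A : ℕ
  A = B +ₙ B′

  open GaussianBinomial A public

  jacobi : ℕ → Series → Series
  jacobi zero f = f
  jacobi (suc n) f = factor (A *ₙ n +ₙ B′) (factor (A *ₙ n +ₙ B) (jacobi n f))

  jacobi-isMultiplier : ∀ n → IsMultiplier (jacobi n)
  jacobi-isMultiplier zero = id-isMultiplier
  jacobi-isMultiplier (suc n) =
    ∘-isMultiplier (factor-isMultiplier (A *ₙ n +ₙ B′))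
      (∘-isMultiplier (factor-isMultiplier (A *ₙ n +ₙ B)) (jacobi-isMultiplier n))

  -- coeff n i f is the coefficient of z^(i-n) in ∏_{k<n} (1 - z q^(Ak+B′)) (1 - z⁻¹ q^(Ak+B)) f.
  coeff : ℕ → ℕ → Series → Series
  coeff zero zero f = f
  coeff zero (suc i) f = 0ₛ
  coeff (suc n) zero f = negate (shift (A *ₙ n +ₙ B) (coeff n 0 f))
  coeff (suc n) (suc zero) f =
    coeff n 0 f ⊕ shift (A *ₙ suc (double n)) (coeff n 0 f) ⊖ shift (A *ₙ n +ₙ B) (coeff n 1 f)
  coeff (suc n) (suc (suc i)) f =
    coeff n (suc i) f ⊕ shift (A *ₙ suc (double n)) (coeff n (suc i) f)
      ⊖ shift (A *ₙ n +ₙ B′) (coeff n i f) ⊖ shift (A *ₙ n +ₙ B) (coeff n (suc (suc i)) f)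

  private
    previous previous₂ : (ℕ → Series) → ℕ → Series
    previous g zero = 0ₛ
    previous g (suc i) = g i
    previous₂ g zero = 0ₛ
    previous₂ g (suc zero) = 0ₛ
    previous₂ g (suc (suc i)) = g i

  coeff-sum : ∀ n J f → double n ≤ J → sumₛ J (λ i → coeff n i f) ≗ jacobi n f
  coeff-sum zero J f _ N = trans (sum-zero J) (ℤP.+-identityʳ (f N))
    where
    sum-zero : ∀ J → sumℤ J (λ i → coeff zero i f N) ≡ f N + + 0
    sum-zero zero = sym (ℤP.+-identityʳ (f N))
    sum-zero (suc J) = trans (sumℤ-unroll J _) (cong (λ t → f N + t) (sumℤ-zero J _ (λ _ _ → refl)))
  coeff-sum (suc n) (suc (suc J)) f (s≤s (s≤s 2n≤J)) N =
    begin
      sumℤ J₂ (λ i → coeff (suc n) i f N)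
    ≡⟨ sumℤ-cong J₂ (λ i _ → coeff-suc i) ⟩
      sumℤ J₂ (λ i → t₁ i + t-c i - t-b′ i - t-b i)
    ≡⟨ sumℤ-- J₂ (λ i → t₁ i + t-c i - t-b′ i) t-b ⟩
      sumℤ J₂ (λ i → t₁ i + t-c i - t-b′ i) - sumℤ J₂ t-b
    ≡⟨ cong (_- sumℤ J₂ t-b)
         (trans (sumℤ-- J₂ (λ i → t₁ i + t-c i) t-b′) (cong (_- sumℤ J₂ t-b′) (sumℤ-+ J₂ t₁ t-c))) ⟩
      sumℤ J₂ t₁ + sumℤ J₂ t-c - sumℤ J₂ t-b′ - sumℤ J₂ t-b
    ≡⟨ cong₂ _-_ (cong₂ _-_ (cong₂ _+_ sum-P sum-X) sum-Y) sum-Z ⟩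
      h N + shift c h N - shift b′ h N - shift b h N
    ≡⟨ expand ⟩
      jacobi (suc n) f N
    ∎
    where
    open ≡-Reasoning
    g : ℕ → Series
    g i = coeff n i f
    h = jacobi n f
    J₂ = suc (suc J)
    b = A *ₙ n +ₙ B
    b′ = A *ₙ n +ₙ B′
    c = A *ₙ suc (double n)
    t₁ t-c t-b′ t-b : ℕ → ℤ
    t₁ i = previous g i N
    t-c i = shift c (previous g i) N
    t-b′ i = shift b′ (previous₂ g i) N
    t-b i = shift b (g i) N
    coeff-suc : ∀ i → coeff (suc n) i f N ≡ t₁ i + t-c i - t-b′ i - t-b i
    coeff-suc zero =
      trans (pad (t-b 0)) (cong₂ (λ u v → + 0 + u - v - t-b 0) (sym (shift-0ₛ c N)) (sym (shift-0ₛ b′ N)))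
      where
      pad : ∀ (x : ℤ) → - x ≡ + 0 + + 0 - + 0 - x
      pad = solve-∀
    coeff-suc (suc zero) = trans (pad (g 0 N) (t-c 1) (t-b 1)) (cong (λ v → g 0 N + t-c 1 - v - t-b 1) (sym (shift-0ₛ b′ N)))
      where
      pad : ∀ (x y z : ℤ) → x + y - z ≡ x + y - + 0 - z
      pad = solve-∀
    coeff-suc (suc (suc i)) = refl
    sum-shift : ∀ s K → double n ≤ K → sumℤ K (λ i → shift s (g i) N) ≡ shift s h N
    sum-shift s K 2n≤K = trans (sym (multiplier-sumₛ (shift-isMultiplier s) K g N)) (shift-cong s (coeff-sum n K f 2n≤K) N)
    2n≤1+J = ℕP.m≤n⇒m≤1+n 2n≤J
    sum-P : sumℤ J₂ t₁ ≡ h N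
    sum-P = trans (sumℤ-dropHead (suc J) t₁ refl) (sum-shift 0 (suc J) 2n≤1+J)
    sum-X : sumℤ J₂ t-c ≡ shift c h N
    sum-X = trans (sumℤ-dropHead (suc J) t-c (shift-0ₛ c N)) (sum-shift c (suc J) 2n≤1+J)
    sum-Y : sumℤ J₂ t-b′ ≡ shift b′ h N
    sum-Y = trans (sumℤ-dropHead (suc J) t-b′ (shift-0ₛ b′ N))
              (trans (sumℤ-dropHead J (λ i → t-b′ (suc i)) (shift-0ₛ b′ N)) (sum-shift b′ J 2n≤J))
    sum-Z : sumℤ J₂ t-b ≡ shift b h N
    sum-Z = sum-shift b J₂ (ℕP.m≤n⇒m≤1+n 2n≤1+J)
    b′+b≡c : b′ +ₙ b ≡ c
    b′+b≡c rewrite double≡+ n = lemma n B B′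
      where
      lemma : ∀ n B B′ → (B +ₙ B′) *ₙ n +ₙ B′ +ₙ ((B +ₙ B′) *ₙ n +ₙ B) ≡ (B +ₙ B′) *ₙ suc (n +ₙ n)
      lemma = ℕSolver.solve-∀
    expand : h N + shift c h N - shift b′ h N - shift b h N ≡ jacobi (suc n) f N
    expand = sym (trans (cong (λ t → factor b h N - t)
                          (trans (shift-factor b′ b h N) (cong (λ t → shift b′ h N - t) (shift-≡ h b′+b≡c N))))
                   (distribute (h N) (shift b h N) (shift b′ h N) (shift c h N)))
      where
      distribute : ∀ (x y z w : ℤ) → (x - y) - (z - w) ≡ x + w - z - y
      distribute = solve-∀

  e⁺ e⁻ : ℕ → ℕ
  e⁺ zero = 0
  e⁺ (suc k) = e⁺ k +ₙ A *ₙ k +ₙ B′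
  e⁻ zero = 0
  e⁻ (suc k) = e⁻ k +ₙ A *ₙ k +ₙ B

  exponent : ℕ → ℕ → ℕ
  exponent n i = e⁺ (i ∸ₙ n) +ₙ e⁻ (n ∸ₙ i)

  exponent-above : ∀ n d → exponent n (n +ₙ d) ≡ e⁺ d
  exponent-above n d rewrite ℕP.m+n∸m≡n n d | ℕP.m≤n⇒m∸n≡0 (ℕP.m≤m+n n d) = ℕP.+-identityʳ (e⁺ d)

  exponent-below : ∀ i d → exponent (i +ₙ d) i ≡ e⁻ d
  exponent-below i d rewrite ℕP.m+n∸m≡n i d | ℕP.m≤n⇒m∸n≡0 (ℕP.m≤m+n i d) = refl

  private
    substitute-+ : ∀ a {b c} d x y → b ≡ x → c ≡ y → a +ₙ x ≡ y +ₙ d → a +ₙ b ≡ c +ₙ d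
    substitute-+ a d x y refl refl h = h

    substitute-+* : ∀ a {b c t} x y z → b ≡ x → c ≡ y → t ≡ z → a +ₙ x ≡ y +ₙ A *ₙ z → a +ₙ b ≡ c +ₙ A *ₙ t
    substitute-+* a x y z refl refl refl h = h

  exponent-B-step₀ : ∀ n → A *ₙ n +ₙ B +ₙ exponent n 0 ≡ exponent (suc n) 0
  exponent-B-step₀ n rewrite ℕP.0∸n≡0 n = lemma n B B′ (e⁻ n)
    where
    lemma : ∀ n B B′ x → (B +ₙ B′) *ₙ n +ₙ B +ₙ (0 +ₙ x) ≡ x +ₙ (B +ₙ B′) *ₙ n +ₙ B
    lemma = ℕSolver.solve-∀

  exponent-B-step₁ : ∀ n → A *ₙ n +ₙ B +ₙ exponent n 1 ≡ exponent n 0 +ₙ A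
  exponent-B-step₁ zero = lemma B B′
    where
    lemma : ∀ B B′ → (B +ₙ B′) *ₙ 0 +ₙ B +ₙ (0 +ₙ (B +ₙ B′) *ₙ 0 +ₙ B′ +ₙ 0) ≡ 0 +ₙ (B +ₙ B′)
    lemma = ℕSolver.solve-∀
  exponent-B-step₁ (suc m) rewrite ℕP.0∸n≡0 m = lemma m B B′ (e⁻ m)
    where
    lemma : ∀ m B B′ x → (B +ₙ B′) *ₙ suc m +ₙ B +ₙ (0 +ₙ x) ≡ x +ₙ (B +ₙ B′) *ₙ m +ₙ B +ₙ (B +ₙ B′)
    lemma = ℕSolver.solve-∀

  exponent-B-step : ∀ n i → A *ₙ n +ₙ B +ₙ exponent n (suc (suc i)) ≡ exponent n (suc i) +ₙ A *ₙ suc (suc i)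
  exponent-B-step n i with ≤⊎> n i
  ... | inj₁ (d , refl) =
    substitute-+ (A *ₙ n +ₙ B) (A *ₙ suc (suc i)) (e⁺ (suc (suc d))) (e⁺ (suc d))
      (trans (cong (exponent n) (+-suc₂ n d)) (exponent-above n (suc (suc d))))
      (trans (cong (exponent n) (sym (ℕP.+-suc n d))) (exponent-above n (suc d)))
      (lemma n d B B′ (e⁺ d))
    where
    +-suc₂ : ∀ n d → suc (suc (n +ₙ d)) ≡ n +ₙ suc (suc d)
    +-suc₂ = ℕSolver.solve-∀
    lemma : ∀ n d B B′ x → (B +ₙ B′) *ₙ n +ₙ B +ₙ (x +ₙ (B +ₙ B′) *ₙ d +ₙ B′ +ₙ (B +ₙ B′) *ₙ suc d +ₙ B′)
              ≡ x +ₙ (B +ₙ B′) *ₙ d +ₙ B′ +ₙ (B +ₙ B′) *ₙ suc (suc (n +ₙ d))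
    lemma = ℕSolver.solve-∀
  ... | inj₂ (zero , refl) =
    substitute-+ (A *ₙ suc (i +ₙ 0) +ₙ B) (A *ₙ suc (suc i)) (e⁺ 1) 0
      (trans (cong (exponent (suc (i +ₙ 0))) (q₂ i)) (exponent-above (suc (i +ₙ 0)) 1))
      (trans (cong (exponent (suc (i +ₙ 0))) (q₁ i)) (exponent-above (suc (i +ₙ 0)) 0))
      (lemma i B B′)
    where
    q₂ : ∀ i → suc (suc i) ≡ suc (i +ₙ 0) +ₙ 1
    q₂ = ℕSolver.solve-∀
    q₁ : ∀ i → suc i ≡ suc (i +ₙ 0) +ₙ 0
    q₁ = ℕSolver.solve-∀
    lemma : ∀ i B B′ → (B +ₙ B′) *ₙ suc (i +ₙ 0) +ₙ B +ₙ (0 +ₙ (B +ₙ B′) *ₙ 0 +ₙ B′) ≡ 0 +ₙ (B +ₙ B′) *ₙ suc (suc i)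
    lemma = ℕSolver.solve-∀
  ... | inj₂ (suc d , refl) =
    substitute-+ (A *ₙ suc (i +ₙ suc d) +ₙ B) (A *ₙ suc (suc i)) (e⁻ d) (e⁻ (suc d))
      (trans (cong (λ m → exponent m (suc (suc i))) (q i d)) (exponent-below (suc (suc i)) d))
      (exponent-below (suc i) (suc d))
      (lemma i d B B′ (e⁻ d))
    where
    q : ∀ i d → suc (i +ₙ suc d) ≡ suc (suc i) +ₙ d
    q = ℕSolver.solve-∀
    lemma : ∀ i d B B′ x → (B +ₙ B′) *ₙ suc (i +ₙ suc d) +ₙ B +ₙ x ≡ x +ₙ (B +ₙ B′) *ₙ d +ₙ B +ₙ (B +ₙ B′) *ₙ suc (suc i)
    lemma = ℕSolver.solve-∀

  exponent-B′-step : ∀ n i → i ≤ double n → A *ₙ n +ₙ B′ +ₙ exponent n i ≡ exponent n (suc i) +ₙ A *ₙ (double n ∸ₙ i)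
  exponent-B′-step n i i≤2n with ≤⊎> n i
  ... | inj₁ (d , refl) with split≤ (ℕP.+-cancelˡ-≤ n d n (subst (n +ₙ d ≤_) (double≡+ n) i≤2n))
  ...   | (e , refl) =
    substitute-+* (A *ₙ (d +ₙ e) +ₙ B′) (e⁺ d) (e⁺ (suc d)) e
      (exponent-above (d +ₙ e) d)
      (trans (cong (exponent (d +ₙ e)) (sym (ℕP.+-suc (d +ₙ e) d))) (exponent-above (d +ₙ e) (suc d)))
      (trans (cong (_∸ₙ ((d +ₙ e) +ₙ d)) (double≡+ (d +ₙ e)))
        (trans (ℕP.[m+n]∸[m+o]≡n∸o (d +ₙ e) (d +ₙ e) d) (ℕP.m+n∸m≡n d e)))
      (lemma d e B B′ (e⁺ d))
    where
    lemma : ∀ d e B B′ x → (B +ₙ B′) *ₙ (d +ₙ e) +ₙ B′ +ₙ x ≡ x +ₙ (B +ₙ B′) *ₙ d +ₙ B′ +ₙ (B +ₙ B′) *ₙ e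
    lemma = ℕSolver.solve-∀
  exponent-B′-step n i i≤2n | inj₂ (d , refl) =
    substitute-+* (A *ₙ (suc i +ₙ d) +ₙ B′) (e⁻ (suc d)) (e⁻ d) (suc (suc (i +ₙ (d +ₙ d))))
      (trans (cong (λ m → exponent m i) (sym (ℕP.+-suc i d))) (exponent-below i (suc d)))
      (exponent-below (suc i) d)
      (trans (cong (_∸ₙ i) (trans (double≡+ (suc i +ₙ d)) (q i d))) (ℕP.m+n∸m≡n i _))
      (lemma i d B B′ (e⁻ d))
    where
    q : ∀ i d → (suc i +ₙ d) +ₙ (suc i +ₙ d) ≡ i +ₙ suc (suc (i +ₙ (d +ₙ d)))
    q = ℕSolver.solve-∀
    lemma : ∀ i d B B′ x → (B +ₙ B′) *ₙ (suc i +ₙ d) +ₙ B′ +ₙ (x +ₙ (B +ₙ B′) *ₙ d +ₙ B)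
              ≡ x +ₙ (B +ₙ B′) *ₙ suc (suc (i +ₙ (d +ₙ d)))
    lemma = ℕSolver.solve-∀

  private
    sum-double : ∀ (e : ℕ → ℕ) C → e 0 ≡ 0 → (∀ k → e (suc k) ≡ e k +ₙ A *ₙ k +ₙ C) →
                 ∀ k → e k *ₙ 2 +ₙ A *ₙ k ≡ k *ₙ (A *ₙ k +ₙ 2 *ₙ C)
    sum-double e C e0 e-suc zero rewrite e0 = ℕP.*-zeroʳ A
    sum-double e C e0 e-suc (suc k) =
      trans (cong (λ t → t *ₙ 2 +ₙ A *ₙ suc k) (e-suc k))
        (trans (split (e k) k C A) (trans (cong (_+ₙ (A *ₙ k +ₙ A *ₙ suc k +ₙ 2 *ₙ C)) (sum-double e C e0 e-suc k)) (merge k C A)))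
      where
      split : ∀ x k C A → (x +ₙ A *ₙ k +ₙ C) *ₙ 2 +ₙ A *ₙ suc k ≡ x *ₙ 2 +ₙ A *ₙ k +ₙ (A *ₙ k +ₙ A *ₙ suc k +ₙ 2 *ₙ C)
      split = ℕSolver.solve-∀
      merge : ∀ k C A → k *ₙ (A *ₙ k +ₙ 2 *ₙ C) +ₙ (A *ₙ k +ₙ A *ₙ suc k +ₙ 2 *ₙ C) ≡ suc k *ₙ (A *ₙ suc k +ₙ 2 *ₙ C)
      merge = ℕSolver.solve-∀

  e⁻≡P : ∀ g → g ∸ₙ 2 ≡ A → g ∸ₙ 4 +ₙ 2 *ₙ B ≡ A → ∀ k → e⁻ k ≡ P g k
  e⁻≡P g g-2≡A c+2B≡A k = sym (half-≡ (begin
      k *ₙ ((g ∸ₙ 2) *ₙ k ∸ₙ c)   ≡⟨ cong (λ a → k *ₙ (a *ₙ k ∸ₙ c)) g-2≡A ⟩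
      k *ₙ (A *ₙ k ∸ₙ c)          ≡⟨ ℕP.*-distribˡ-∸ k (A *ₙ k) c ⟩
      k *ₙ (A *ₙ k) ∸ₙ k *ₙ c     ≡⟨ cong (_∸ₙ k *ₙ c) (sym doubled) ⟩
      e⁻ k *ₙ 2 +ₙ k *ₙ c ∸ₙ k *ₙ c ≡⟨ ℕP.m+n∸n≡m (e⁻ k *ₙ 2) (k *ₙ c) ⟩
      e⁻ k *ₙ 2                   ∎))
    where
    open ≡-Reasoning
    c = g ∸ₙ 4
    doubled : e⁻ k *ₙ 2 +ₙ k *ₙ c ≡ k *ₙ (A *ₙ k)
    doubled = ℕP.+-cancelʳ-≡ (2 *ₙ B *ₙ k) _ _ (begin
      e⁻ k *ₙ 2 +ₙ k *ₙ c +ₙ 2 *ₙ B *ₙ k ≡⟨ regroup (e⁻ k) k c B ⟩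
      e⁻ k *ₙ 2 +ₙ (c +ₙ 2 *ₙ B) *ₙ k    ≡⟨ cong (λ a → e⁻ k *ₙ 2 +ₙ a *ₙ k) c+2B≡A ⟩
      e⁻ k *ₙ 2 +ₙ A *ₙ k                ≡⟨ sum-double e⁻ B refl (λ _ → refl) k ⟩
      k *ₙ (A *ₙ k +ₙ 2 *ₙ B)            ≡⟨ expand k (A *ₙ k) B ⟩
      k *ₙ (A *ₙ k) +ₙ 2 *ₙ B *ₙ k       ∎)
      where
      regroup : ∀ x k c B → x *ₙ 2 +ₙ k *ₙ c +ₙ 2 *ₙ B *ₙ k ≡ x *ₙ 2 +ₙ (c +ₙ 2 *ₙ B) *ₙ k
      regroup = ℕSolver.solve-∀
      expand : ∀ k a B → k *ₙ (a +ₙ 2 *ₙ B) ≡ k *ₙ a +ₙ 2 *ₙ B *ₙ k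
      expand = ℕSolver.solve-∀

  e⁺≡Q : ∀ g → g ∸ₙ 2 ≡ A → g ∸ₙ 4 +ₙ A ≡ 2 *ₙ B′ → ∀ k → e⁺ k ≡ Q g k
  e⁺≡Q g g-2≡A c+A≡2B′ k = sym (half-≡ (begin
      k *ₙ ((g ∸ₙ 2) *ₙ k +ₙ c) ≡⟨ cong (λ a → k *ₙ (a *ₙ k +ₙ c)) g-2≡A ⟩
      k *ₙ (A *ₙ k +ₙ c)        ≡⟨ ℕP.+-cancelʳ-≡ (A *ₙ k) _ _ doubled ⟩
      e⁺ k *ₙ 2                 ∎))
    where
    open ≡-Reasoning
    c = g ∸ₙ 4
    doubled : k *ₙ (A *ₙ k +ₙ c) +ₙ A *ₙ k ≡ e⁺ k *ₙ 2 +ₙ A *ₙ k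
    doubled = begin
      k *ₙ (A *ₙ k +ₙ c) +ₙ A *ₙ k ≡⟨ regroup k (A *ₙ k) c A ⟩
      k *ₙ (A *ₙ k +ₙ (c +ₙ A))    ≡⟨ cong (λ a → k *ₙ (A *ₙ k +ₙ a)) c+A≡2B′ ⟩
      k *ₙ (A *ₙ k +ₙ 2 *ₙ B′)     ≡⟨ sym (sum-double e⁺ B′ refl (λ _ → refl) k) ⟩
      e⁺ k *ₙ 2 +ₙ A *ₙ k          ∎
      where
      regroup : ∀ k a c A → k *ₙ (a +ₙ c) +ₙ A *ₙ k ≡ k *ₙ (a +ₙ (c +ₙ A))
      regroup = ℕSolver.solve-∀

  jacobiTerm : ℕ → ℕ → Series → Series
  jacobiTerm n i f = alt (n +ₙ i) ⊙ shift (exponent n i) (binom (double n) i f)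

  private
    shift-signed : ∀ a σ e Q N → shift a (σ ⊙ shift e Q) N ≡ σ * shift (a +ₙ e) Q N
    shift-signed a σ e Q N = trans (shift-⊙ a σ (shift e Q) N) (cong (σ *_) (shift-shift a e Q N))

    alt-suc-+-suc : ∀ n i → alt (suc n +ₙ suc i) ≡ alt (n +ₙ i)
    alt-suc-+-suc n i = trans (cong -_ (alt-+-suc n i)) (ℤP.neg-involutive _)

  coeff-closed : ∀ n i f → coeff n i f ≗ jacobiTerm n i f
  coeff-closed zero zero f N = sym (ℤP.*-identityˡ (f N))
  coeff-closed zero (suc i) f N =
    sym (trans (cong (alt (suc i) *_) (shift-0ₛ (exponent 0 (suc i)) N)) (ℤP.*-zeroʳ (alt (suc i))))
  coeff-closed (suc n) zero f N =
    trans (cong -_ (trans (shift-cong b (coeff-closed n 0 f) N) (shift-signed b σ (exponent n 0) f N)))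
      (trans (ℤP.neg-distribˡ-* σ _) (cong (λ t → - σ * t) (shift-≡ f (exponent-B-step₀ n) N)))
    where
    b = A *ₙ n +ₙ B
    σ = alt (n +ₙ 0)
  coeff-closed (suc n) (suc zero) f N =
    begin
      coeff n 0 f N + shift c (coeff n 0 f) N - shift b (coeff n 1 f) N
    ≡⟨ cong₂ _-_ (cong₂ _+_ (coeff-closed n 0 f N) term-c) term-b ⟩
      σ * x + σ * y - (- σ) * z
    ≡⟨ collect σ x y z ⟩
      σ * (x + y + z)
    ≡⟨ cong₂ _*_ (sym (alt-suc-+-suc n 0)) (sym pascal) ⟩
      jacobiTerm (suc n) 1 f N
    ∎
    where
    open ≡-Reasoning
    b = A *ₙ n +ₙ B
    c = A *ₙ suc (double n)
    σ = alt (n +ₙ 0)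
    E₀ = exponent n 0
    E₁ = exponent n 1
    Q₁ = binom (double n) 1 f
    x = shift E₀ f N
    y = shift (c +ₙ E₀) f N
    z = shift (b +ₙ E₁) Q₁ N
    term-c : shift c (coeff n 0 f) N ≡ σ * y
    term-c = trans (shift-cong c (coeff-closed n 0 f) N) (shift-signed c σ E₀ f N)
    term-b : shift b (coeff n 1 f) N ≡ - σ * z
    term-b = trans (shift-cong b (coeff-closed n 1 f) N)
               (trans (shift-signed b (alt (n +ₙ 1)) E₁ Q₁ N) (cong (_* z) (alt-+-suc n 0)))
    collect : ∀ (σ x y z : ℤ) → σ * x + σ * y - (- σ) * z ≡ σ * (x + y + z)
    collect = solve-∀
    pascal : shift E₀ (binom (suc (suc (double n))) 1 f) N ≡ x + y + z
    pascal =
      trans (shift-cong E₀ (binom-pascal₂-1 (double n) f) N)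
        (trans (shift-⊕ E₀ (f ⊕ shift c f) (shift (A *ₙ 1) Q₁) N)
          (cong₂ _+_ (trans (shift-⊕ E₀ f (shift c f) N)
                       (cong (λ t → x + t) (trans (shift-shift E₀ c f N) (shift-≡ f (ℕP.+-comm E₀ c) N))))
                     (trans (shift-shift E₀ (A *ₙ 1) Q₁ N) (shift-≡ Q₁ exponent-eq N))))
      where
      exponent-eq : E₀ +ₙ A *ₙ 1 ≡ b +ₙ E₁
      exponent-eq = trans (cong (E₀ +ₙ_) (ℕP.*-identityʳ A)) (sym (exponent-B-step₁ n))
  coeff-closed (suc n) (suc (suc i)) f N =
    begin
      coeff n (suc i) f N + shift c (coeff n (suc i) f) N - shift b′ (coeff n i f) N - shift b (coeff n (suc (suc i)) f) N
    ≡⟨ cong₂ _-_ (cong₂ _-_ (cong₂ _+_ (coeff-closed n (suc i) f N) term-c) term-b′) term-b ⟩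
      σ * x + σ * y - (- σ) * z - (- σ) * w
    ≡⟨ collect σ x y z w ⟩
      σ * (x + y + z + w)
    ≡⟨ cong₂ _*_ (sym (alt-suc-+-suc n (suc i))) (sym pascal) ⟩
      jacobiTerm (suc n) (suc (suc i)) f N
    ∎
    where
    open ≡-Reasoning
    b = A *ₙ n +ₙ B
    b′ = A *ₙ n +ₙ B′
    c = A *ₙ suc (double n)
    d = A *ₙ (double n ∸ₙ i)
    a = A *ₙ suc (suc i)
    σ = alt (n +ₙ suc i)
    E₀ = exponent n i
    E₁ = exponent n (suc i)
    E₂ = exponent n (suc (suc i))
    Q₀ = binom (double n) i f
    Q₁ = binom (double n) (suc i) f
    Q₂ = binom (double n) (suc (suc i)) f
    x = shift E₁ Q₁ N
    y = shift (c +ₙ E₁) Q₁ N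
    z = shift (b′ +ₙ E₀) Q₀ N
    w = shift (b +ₙ E₂) Q₂ N
    term-c : shift c (coeff n (suc i) f) N ≡ σ * y
    term-c = trans (shift-cong c (coeff-closed n (suc i) f) N) (shift-signed c σ E₁ Q₁ N)
    term-b′ : shift b′ (coeff n i f) N ≡ - σ * z
    term-b′ = trans (shift-cong b′ (coeff-closed n i f) N)
                (trans (shift-signed b′ (alt (n +ₙ i)) E₀ Q₀ N)
                  (cong (_* z) (trans (sym (ℤP.neg-involutive _)) (cong -_ (sym (alt-+-suc n i))))))
    term-b : shift b (coeff n (suc (suc i)) f) N ≡ - σ * w
    term-b = trans (shift-cong b (coeff-closed n (suc (suc i)) f) N)
               (trans (shift-signed b (alt (n +ₙ suc (suc i))) E₂ Q₂ N) (cong (_* w) (alt-+-suc n (suc i))))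
    collect : ∀ (σ x y z w : ℤ) → σ * x + σ * y - (- σ) * z - (- σ) * w ≡ σ * (x + y + z + w)
    collect = solve-∀
    lower : shift (E₁ +ₙ d) Q₀ N ≡ z
    lower with ℕP.≤-<-connex i (double n)
    ... | inj₁ i≤2n = shift-≡ Q₀ (sym (exponent-B′-step n i i≤2n)) N
    ... | inj₂ 2n<i = trans (vanishes (E₁ +ₙ d)) (sym (vanishes (b′ +ₙ E₀)))
      where
      vanishes : ∀ s → shift s Q₀ N ≡ + 0
      vanishes s = trans (shift-cong s (binom-vanish (double n) i f 2n<i) N) (shift-0ₛ s N)
    pascal : shift E₁ (binom (suc (suc (double n))) (suc (suc i)) f) N ≡ x + y + z + w
    pascal =
      trans (shift-cong E₁ (binom-pascal₂ (double n) i f) N)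
        (trans (shift-⊕ E₁ (Q₁ ⊕ shift c Q₁ ⊕ shift d Q₀) (shift a Q₂) N)
          (cong₂ _+_
            (trans (shift-⊕ E₁ (Q₁ ⊕ shift c Q₁) (shift d Q₀) N)
              (cong₂ _+_
                (trans (shift-⊕ E₁ Q₁ (shift c Q₁) N)
                  (cong (λ t → x + t) (trans (shift-shift E₁ c Q₁ N) (shift-≡ Q₁ (ℕP.+-comm E₁ c) N))))
                (trans (shift-shift E₁ d Q₀ N) lower)))
            (trans (shift-shift E₁ a Q₂ N) (shift-≡ Q₂ (sym (exponent-B-step n i)) N))))

  jacobi-expand : ∀ n f → jacobi n f ≗ sumₛ (double n) (λ i → jacobiTerm n i f)
  jacobi-expand n f N =
    trans (sym (coeff-sum n (double n) f ℕP.≤-refl N)) (sumℤ-cong (double n) (λ i _ → coeff-closed n i f N))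

  thetaTerm : ℕ → Series → Series
  thetaTerm zero f = f
  thetaTerm (suc k) f = shift (e⁻ (suc k)) f ⊕ shift (e⁺ (suc k)) f

  theta : ℕ → Series → Series
  theta n f = sumₛ n (λ k → alt k ⊙ thetaTerm k f)

  theta-reindex : ∀ n f → sumₛ (double n) (λ i → alt (n +ₙ i) ⊙ shift (exponent n i) f) ≗ theta n f
  theta-reindex zero f N = refl
  theta-reindex (suc n) f N =
    trans (cong (_+ t (suc (suc D))) (sumℤ-unroll D t))
      (trans (cong (λ u → t 0 + u + t (suc (suc D))) inner)
        (trans (cong₂ (λ u v → u + theta n f N + v) first last)
          (regroup (alt (suc n)) (shift (e⁻ (suc n)) f N) (shift (e⁺ (suc n)) f N) (theta n f N))))
    where
    D = double n
    t : ℕ → ℤ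
    t i = alt (suc n +ₙ i) * shift (exponent (suc n) i) f N
    inner : sumℤ D (λ i → t (suc i)) ≡ theta n f N
    inner = trans (sumℤ-cong D (λ i _ → cong (_* shift (exponent n i) f N) (alt-suc-+-suc n i)))
              (theta-reindex n f N)
    first : t 0 ≡ alt (suc n) * shift (e⁻ (suc n)) f N
    first = cong (λ k → alt k * shift (e⁻ (suc n)) f N) (ℕP.+-identityʳ (suc n))
    last-exponent : exponent n (suc D) ≡ e⁺ (suc n)
    last-exponent = trans (cong (exponent n) (trans (cong suc (double≡+ n)) (sym (ℕP.+-suc n n))))
                      (exponent-above n (suc n))
    last : t (suc (suc D)) ≡ alt (suc n) * shift (e⁺ (suc n)) f N
    last = cong₂ _*_ (alt-+-double (suc n) (suc n)) (shift-≡ f last-exponent N)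
    regroup : ∀ (s p q t : ℤ) → s * p + t + s * q ≡ t + s * (p + q)
    regroup = solve-∀

  module Truncation (B>0 : 0 < B) (B′>0 : 0 < B′) where

    A>0 : 0 < A
    A>0 = ℕP.<-≤-trans B>0 (ℕP.m≤m+n B B′)

    ≤A* : ∀ x → x ≤ A *ₙ x
    ≤A* x = ℕP.m≤n*m x A ⦃ >-nonZero A>0 ⦄

    e⁺-≥ : ∀ d → d ≤ e⁺ d
    e⁺-≥ zero = z≤n
    e⁺-≥ (suc d) = subst (_≤ e⁺ d +ₙ A *ₙ d +ₙ B′) (ℕP.+-comm d 1)
                     (ℕP.+-mono-≤ (ℕP.≤-trans (e⁺-≥ d) (ℕP.m≤m+n (e⁺ d) (A *ₙ d))) B′>0)

    e⁻-≥ : ∀ d → d ≤ e⁻ d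
    e⁻-≥ zero = z≤n
    e⁻-≥ (suc d) = subst (_≤ e⁻ d +ₙ A *ₙ d +ₙ B) (ℕP.+-comm d 1)
                     (ℕP.+-mono-≤ (ℕP.≤-trans (e⁻-≥ d) (ℕP.m≤m+n (e⁻ d) (A *ₙ d))) B>0)

    -- (q)_n (q)_n [i+k, i] ≡ (q)_i (q)_k [i+k, i] = (q)_(i+k) ≡ (q)_n modulo q^(A(m+1)); then cancel (q)_n.
    poch-binom-≈ : ∀ {M} n i k f m → M ≡ i +ₙ k → m ≤ i → m ≤ k → m ≤ n → poch n (binom M i f) ≈[ A *ₙ suc m ] f
    poch-binom-≈ n i k f m refl m≤i m≤k m≤n N N<A[1+m] =
      ℤP.i-j≡0⇒i≡j _ _ (poch-cancel A>0 n (A *ₙ suc m) (poch n Bin ⊖ f) difference N N<A[1+m])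
      where
      Bin = binom (i +ₙ k) i f
      truncate₂ : ∀ a b → m ≤ a → m ≤ b → poch a (poch b Bin) ≈[ A *ₙ suc m ] poch m (poch m Bin)
      truncate₂ a b m≤a m≤b = ≈-trans (poch-≈ m a (poch b Bin) m≤a) (≈-cong (poch-isMultiplier m) _ (poch-≈ m b Bin m≤b))
      squared : poch n (poch n Bin) ≈[ A *ₙ suc m ] poch n f
      squared = ≈-trans (truncate₂ n n m≤n m≤n)
                  (≈-trans (≈-sym (truncate₂ i k m≤i m≤k))
                    (≈-trans (≗⇒≈ (poch-binom i k f))
                      (≈-trans (poch-≈ m (i +ₙ k) f (ℕP.≤-trans m≤i (ℕP.m≤m+n i k))) (≈-sym (poch-≈ m n f m≤n)))))
      difference : poch n (poch n Bin ⊖ f) ≈[ A *ₙ suc m ] 0ₛ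
      difference N l = trans (⊖-homo (poch-isMultiplier n) (poch n Bin) f N)
                         (trans (cong (_- poch n f N) (squared N l)) (ℤP.+-inverseʳ (poch n f N)))

    poch-jacobiTerm : ∀ n i f → i ≤ double n → poch n (jacobiTerm n i f) ≈[ suc n ] alt (n +ₙ i) ⊙ shift (exponent n i) f
    poch-jacobiTerm n i f i≤2n N l =
      trans (⊙-homo (poch-isMultiplier n) (alt (n +ₙ i)) (shift (exponent n i) Bin) N)
        (cong (alt (n +ₙ i) *_) (trans (shift-homo (poch-isMultiplier n) (exponent n i) Bin N) (shifted (≤⊎> n i) N l)))
      where
      Bin = binom (double n) i f
      within : ∀ {m} → poch n Bin ≈[ A *ₙ suc m ] f → suc n ≤ exponent n i +ₙ A *ₙ suc m →
               shift (exponent n i) (poch n Bin) ≈[ suc n ] shift (exponent n i) f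
      within {m} close n<E+A[1+m] = ≈-weaken n<E+A[1+m] (shift-≈-+ (exponent n i) (A *ₙ suc m) close)
      shifted : (∃ λ d → i ≡ n +ₙ d) ⊎ (∃ λ d → n ≡ suc i +ₙ d) →
                shift (exponent n i) (poch n Bin) ≈[ suc n ] shift (exponent n i) f
      shifted (inj₁ (d , refl)) with split≤ (ℕP.+-cancelˡ-≤ n d n (subst (n +ₙ d ≤_) (double≡+ n) i≤2n))
      ... | (e , refl) =
        within (poch-binom-≈ (d +ₙ e) i e f e 2n≡i+e
                  (ℕP.≤-trans (ℕP.m≤n+m e d) (ℕP.m≤m+n (d +ₙ e) d)) ℕP.≤-refl (ℕP.m≤n+m e d))
          (ℕP.≤-trans (ℕP.≤-reflexive (sym (ℕP.+-suc d e)))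
            (ℕP.+-mono-≤ (subst (d ≤_) (sym (exponent-above (d +ₙ e) d)) (e⁺-≥ d)) (≤A* (suc e))))
        where
        2n≡i+e : double (d +ₙ e) ≡ (d +ₙ e) +ₙ d +ₙ e
        2n≡i+e = trans (double≡+ (d +ₙ e)) (lemma d e)
          where
          lemma : ∀ d e → (d +ₙ e) +ₙ (d +ₙ e) ≡ (d +ₙ e) +ₙ d +ₙ e
          lemma = ℕSolver.solve-∀
      shifted (inj₂ (d , refl)) =
        within (poch-binom-≈ (suc i +ₙ d) i (suc (suc (i +ₙ (d +ₙ d)))) f i 2n≡i+k ℕP.≤-refl
                  (ℕP.≤-trans (ℕP.m≤m+n i (d +ₙ d)) (ℕP.≤-trans (ℕP.n≤1+n _) (ℕP.n≤1+n _)))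
                  (ℕP.≤-trans (ℕP.n≤1+n i) (ℕP.m≤m+n (suc i) d)))
          (ℕP.≤-trans (ℕP.≤-reflexive (lemma i d))
            (ℕP.+-mono-≤ (subst (suc d ≤_) (sym E≡) (e⁻-≥ (suc d))) (≤A* (suc i))))
        where
        2n≡i+k : double (suc i +ₙ d) ≡ i +ₙ suc (suc (i +ₙ (d +ₙ d)))
        2n≡i+k = trans (double≡+ (suc i +ₙ d)) (lemma′ i d)
          where
          lemma′ : ∀ i d → (suc i +ₙ d) +ₙ (suc i +ₙ d) ≡ i +ₙ suc (suc (i +ₙ (d +ₙ d)))
          lemma′ = ℕSolver.solve-∀
        E≡ : exponent (suc i +ₙ d) i ≡ e⁻ (suc d)
        E≡ = trans (cong (λ m → exponent m i) (sym (ℕP.+-suc i d))) (exponent-below i (suc d))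
        lemma : ∀ i d → suc (suc i +ₙ d) ≡ suc d +ₙ suc i
        lemma = ℕSolver.solve-∀

    poch-jacobi : ∀ n f → poch n (jacobi n f) ≈[ suc n ] theta n f
    poch-jacobi n f N l =
      begin
        poch n (jacobi n f) N
      ≡⟨ ≗-cong (poch-isMultiplier n) (jacobi-expand n f) N ⟩
        poch n (sumₛ (double n) (λ i → jacobiTerm n i f)) N
      ≡⟨ multiplier-sumₛ (poch-isMultiplier n) (double n) _ N ⟩
        sumℤ (double n) (λ i → poch n (jacobiTerm n i f) N)
      ≡⟨ sumℤ-cong (double n) (λ i i≤2n → poch-jacobiTerm n i f i≤2n N l) ⟩
        sumₛ (double n) (λ i → alt (n +ₙ i) ⊙ shift (exponent n i) f) N
      ≡⟨ theta-reindex n f N ⟩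
        theta n f N
      ∎
      where
      open ≡-Reasoning

    theta-stable : ∀ n d f N → N ≤ n → theta (n +ₙ d) f N ≡ theta n f N
    theta-stable n zero f N _ = cong (λ t → theta t f N) (ℕP.+-identityʳ n)
    theta-stable n (suc d) f N N≤n rewrite ℕP.+-suc n d =
      trans (cong (λ t → theta (n +ₙ d) f N + t)
               (trans (cong (alt k *_) (cong₂ _+_ (beyond e⁻ e⁻-≥) (beyond e⁺ e⁺-≥))) (ℤP.*-zeroʳ (alt k))))
        (trans (ℤP.+-identityʳ _) (theta-stable n d f N N≤n))
      where
      k = suc (n +ₙ d)
      beyond : ∀ e → (∀ j → j ≤ e j) → shift (e k) f N ≡ + 0
      beyond e e-≥ = shift-below (e k) f N (ℕP.<-≤-trans (s≤s (ℕP.≤-trans N≤n (ℕP.m≤m+n n d))) (e-≥ k))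

factorIf : Bool → ℕ → Series → Series
factorIf true s f = factor s f
factorIf false s f = f

factorIf-isMultiplier : ∀ b s → IsMultiplier (factorIf b s)
factorIf-isMultiplier true s = factor-isMultiplier s
factorIf-isMultiplier false s = id-isMultiplier

partFactors : ℕ → Series → Series
partFactors zero f = f
partFactors (suc m) f = partFactors m (factorIf (allowed (suc m)) (suc m) f)

partFactors-isMultiplier : ∀ m → IsMultiplier (partFactors m)
partFactors-isMultiplier zero = id-isMultiplier
partFactors-isMultiplier (suc m) =
  ∘-isMultiplier (partFactors-isMultiplier m) (factorIf-isMultiplier (allowed (suc m)) (suc m))

countSeries : ℕ → Series
countSeries m N = + countUpTo m N

p14Series : Series
p14Series N = + p14 N

-- Summing over the multiplicity of the part m+1 gives countUpTo (m+1) N = countUpTo m N + countUpTo (m+1) (N-m-1),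
-- so multiplying by 1 - q^(m+1) removes that part size.
module _ (m : ℕ) where
  private
    s = suc m
    multiplicities : ℕ → ℕ
    multiplicities N = sumTo (N / s) (λ j → countUpTo m (N ∸ₙ j *ₙ s))

  multiplicities-< : ∀ N → N < s → multiplicities N ≡ countUpTo m N
  multiplicities-< N N<s rewrite ℕDM.m<n⇒m/n≡0 {N} {s} N<s = refl

  multiplicities-+ : ∀ N → multiplicities (s +ₙ N) ≡ countUpTo m (s +ₙ N) +ₙ multiplicities N
  multiplicities-+ N rewrite ℕDM.m/n≡1+[m∸n]/n {s +ₙ N} {s} (ℕP.m≤m+n s N) | ℕP.m+n∸m≡n s N =
    trans (sumTo-unroll (N / s) _)
      (cong (countUpTo m (s +ₙ N) +ₙ_) (sumTo-cong (N / s) (λ j → cong (countUpTo m) (ℕP.[m+n]∸[m+o]≡n∸o s N (j *ₙ s)))))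
    where
    sumTo-unroll : ∀ J g → sumTo (suc J) g ≡ g 0 +ₙ sumTo J (λ j → g (suc j))
    sumTo-unroll zero g = refl
    sumTo-unroll (suc J) g = trans (cong (_+ₙ g (suc (suc J))) (sumTo-unroll J g)) (ℕP.+-assoc (g 0) _ _)
    sumTo-cong : ∀ J {g h : ℕ → ℕ} → (∀ j → g j ≡ h j) → sumTo J g ≡ sumTo J h
    sumTo-cong zero p = p 0
    sumTo-cong (suc J) p = cong₂ _+ₙ_ (sumTo-cong J p) (p (suc J))

  factorIf-countSeries : factorIf (allowed s) s (countSeries s) ≗ countSeries m
  factorIf-countSeries N with allowed s
  ... | false = refl
  ... | true with <⊎+ s N
  ...   | inj₁ N<s =
    trans (cong (λ t → + multiplicities N - t) (shift-below s _ N N<s))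
      (trans (ℤP.+-identityʳ _) (cong +_ (multiplicities-< N N<s)))
  ...   | inj₂ (N′ , refl) =
    trans (cong (λ t → + multiplicities (s +ₙ N′) - t) (shift-+ s (λ K → + multiplicities K) N′))
      (trans (cong (λ t → + t - + multiplicities N′) (multiplicities-+ N′))
        (trans (cong (_- + multiplicities N′) (ℤP.pos-+ (countUpTo m (s +ₙ N′)) (multiplicities N′)))
          (cancel (+ countUpTo m (s +ₙ N′)) (+ multiplicities N′))))
    where
    cancel : ∀ (a b : ℤ) → a + b - b ≡ a
    cancel = solve-∀

partFactors-countSeries : ∀ m → partFactors m (countSeries m) ≗ 1ₛ
partFactors-countSeries zero zero = refl
partFactors-countSeries zero (suc N) = refl
partFactors-countSeries (suc m) =
  ≗-trans (≗-cong (partFactors-isMultiplier m) (factorIf-countSeries m)) (partFactors-countSeries m)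

countUpTo-stable : ∀ N d → countUpTo (N +ₙ d) N ≡ countUpTo N N
countUpTo-stable N zero = cong (λ t → countUpTo t N) (ℕP.+-identityʳ N)
countUpTo-stable N (suc d) rewrite ℕP.+-suc N d = trans (too-large (allowed (suc (N +ₙ d)))) (countUpTo-stable N d)
  where
  too-large : ∀ b → (if b then sumTo (N / suc (N +ₙ d)) (λ j → countUpTo (N +ₙ d) (N ∸ₙ j *ₙ suc (N +ₙ d)))
                     else countUpTo (N +ₙ d) N) ≡ countUpTo (N +ₙ d) N
  too-large false = refl
  too-large true rewrite ℕDM.m<n⇒m/n≡0 {N} {suc (N +ₙ d)} (s≤s (ℕP.m≤m+n N d)) = refl

p14Series≈countSeries : ∀ m → p14Series ≈[ suc m ] countSeries m
p14Series≈countSeries m N (s≤s N≤m) with split≤ N≤m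
... | (d , refl) = cong +_ (sym (countUpTo-stable N d))

partFactors-p14 : ∀ m → partFactors m p14Series ≈[ suc m ] 1ₛ
partFactors-p14 m N l =
  trans (≈-cong (partFactors-isMultiplier m) (suc m) (p14Series≈countSeries m) N l) (partFactors-countSeries m N)

module Base5 = TripleProduct 1 4
module Base15 = TripleProduct 5 10
module Truncated5 = Base5.Truncation (s≤s z≤n) (s≤s z≤n)
module Truncated15 = Base15.Truncation (s≤s z≤n) (s≤s z≤n)

allowed-+*5 : ∀ j n → allowed (j +ₙ n *ₙ 5) ≡ allowed j
allowed-+*5 j n = cong (λ r → (r ≡ᵇ 1) ∨ (r ≡ᵇ 4)) (ℕDM.[m+kn]%n≡m%n j n 5)

partFactors-suc : ∀ k b f → allowed (suc k) ≡ b → partFactors (suc k) f ≗ partFactors k (factorIf b (suc k) f)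
partFactors-suc k b f refl _ = refl

partFactors-+5 : ∀ n f →
  partFactors (suc n *ₙ 5) f ≗ partFactors (n *ₙ 5) (factor (1 +ₙ n *ₙ 5) (factor (4 +ₙ n *ₙ 5) f))
partFactors-+5 n f =
  ≗-trans (partFactors-suc (4 +ₙ x) false f (allowed-+*5 5 n))
    (≗-trans (partFactors-suc (3 +ₙ x) true f (allowed-+*5 4 n))
      (≗-trans (partFactors-suc (2 +ₙ x) false (factor (4 +ₙ x) f) (allowed-+*5 3 n))
        (≗-trans (partFactors-suc (1 +ₙ x) false (factor (4 +ₙ x) f) (allowed-+*5 2 n))
          (partFactors-suc x true (factor (4 +ₙ x) f) (allowed-+*5 1 n)))))
  where
  x = n *ₙ 5

jacobi₅≗partFactors : ∀ n f → Base5.jacobi n f ≗ partFactors (n *ₙ 5) f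
jacobi₅≗partFactors zero f _ = refl
jacobi₅≗partFactors (suc n) f =
  begin
    Base5.jacobi (suc n) f
  ≈⟨ factor₂-≡ (Base5.jacobi n f) (sym (e₄ n)) (sym (e₁ n)) ⟩
    factor (4 +ₙ x) (factor (1 +ₙ x) (Base5.jacobi n f))
  ≈⟨ ≗-sym (factor-comm (factor-isMultiplier (4 +ₙ x)) (1 +ₙ x) (Base5.jacobi n f)) ⟩
    factor (1 +ₙ x) (factor (4 +ₙ x) (Base5.jacobi n f))
  ≈⟨ ≗-cong (factor-isMultiplier (1 +ₙ x)) (factor-comm (Base5.jacobi-isMultiplier n) (4 +ₙ x) f) ⟩
    factor (1 +ₙ x) (Base5.jacobi n (factor (4 +ₙ x) f))
  ≈⟨ factor-comm (Base5.jacobi-isMultiplier n) (1 +ₙ x) (factor (4 +ₙ x) f) ⟩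
    Base5.jacobi n (factor (1 +ₙ x) (factor (4 +ₙ x) f))
  ≈⟨ jacobi₅≗partFactors n (factor (1 +ₙ x) (factor (4 +ₙ x) f)) ⟩
    partFactors x (factor (1 +ₙ x) (factor (4 +ₙ x) f))
  ≈⟨ ≗-sym (partFactors-+5 n f) ⟩
    partFactors (suc n *ₙ 5) f
  ∎
  where
  open SetoidReasoning (ℕ →-setoid ℤ)
  x = n *ₙ 5
  factor₂-≡ : ∀ {a a′ b b′} g → a ≡ a′ → b ≡ b′ → factor a (factor b g) ≗ factor a′ (factor b′ g)
  factor₂-≡ g refl refl _ = refl
  e₄ : ∀ n → 4 +ₙ n *ₙ 5 ≡ 5 *ₙ n +ₙ 4
  e₄ = ℕSolver.solve-∀
  e₁ : ∀ n → 1 +ₙ n *ₙ 5 ≡ 5 *ₙ n +ₙ 1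
  e₁ = ℕSolver.solve-∀

-- The three factors 1 - q^(15n+5), 1 - q^(15n+10), 1 - q^(15n+15) are 1 - q^(5k) for k = 3n+1, 3n+2, 3n+3.
poch₁₅-jacobi₁₅ : ∀ n f → Base15.poch n (Base15.jacobi n f) ≗ Base5.poch (n *ₙ 3) f
poch₁₅-jacobi₁₅ zero f _ = refl
poch₁₅-jacobi₁₅ (suc n) f =
  begin
    factor a (Base15.poch n (factor b (factor c (Base15.jacobi n f))))
  ≈⟨ ≗-cong (factor-isMultiplier a) (≗-sym (factor-comm (Base15.poch-isMultiplier n) b _)) ⟩
    factor a (factor b (Base15.poch n (factor c (Base15.jacobi n f))))
  ≈⟨ ≗-cong (factor-isMultiplier a) (≗-cong (factor-isMultiplier b) (≗-sym (factor-comm (Base15.poch-isMultiplier n) c _))) ⟩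
    factor a (factor b (factor c (Base15.poch n (Base15.jacobi n f))))
  ≈⟨ ≗-cong (factor-isMultiplier a) (≗-cong (factor-isMultiplier b) (≗-cong (factor-isMultiplier c) (poch₁₅-jacobi₁₅ n f))) ⟩
    factor a (factor b (factor c (Base5.poch (n *ₙ 3) f)))
  ≈⟨ factor₃-≡ (Base5.poch (n *ₙ 3) f) (e₃ n) (e₂ n) (e₁ n) ⟩
    Base5.poch (suc n *ₙ 3) f
  ∎
  where
  open SetoidReasoning (ℕ →-setoid ℤ)
  a = 15 *ₙ suc n
  b = 15 *ₙ n +ₙ 10
  c = 15 *ₙ n +ₙ 5
  factor₃-≡ : ∀ {a a′ b b′ c c′} g → a ≡ a′ → b ≡ b′ → c ≡ c′ →
              factor a (factor b (factor c g)) ≗ factor a′ (factor b′ (factor c′ g))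
  factor₃-≡ g refl refl refl _ = refl
  e₃ : ∀ n → 15 *ₙ suc n ≡ 5 *ₙ suc (suc (suc (n *ₙ 3)))
  e₃ = ℕSolver.solve-∀
  e₂ : ∀ n → 15 *ₙ n +ₙ 10 ≡ 5 *ₙ suc (suc (n *ₙ 3))
  e₂ = ℕSolver.solve-∀
  e₁ : ∀ n → 15 *ₙ n +ₙ 5 ≡ 5 *ₙ suc (n *ₙ 3)
  e₁ = ℕSolver.solve-∀

theta₅-p14≈theta₁₅ : ∀ n → Base5.theta n p14Series ≈[ suc n ] Base15.theta n 1ₛ
theta₅-p14≈theta₁₅ n =
  begin
    Base5.theta n p14Series
  ≈⟨ ≈-sym (Truncated5.poch-jacobi n p14Series) ⟩
    Base5.poch n (Base5.jacobi n p14Series)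
  ≈⟨ ≗⇒≈ (≗-cong (Base5.poch-isMultiplier n) (jacobi₅≗partFactors n p14Series)) ⟩
    Base5.poch n (partFactors (n *ₙ 5) p14Series)
  ≈⟨ ≈-weaken (s≤s (ℕP.m≤m*n n 5)) (≈-cong (Base5.poch-isMultiplier n) (suc (n *ₙ 5)) (partFactors-p14 (n *ₙ 5))) ⟩
    Base5.poch n 1ₛ
  ≈⟨ ≈-weaken (ℕP.m≤n*m (suc n) 5) (≈-sym (Base5.poch-≈ n (n *ₙ 3) 1ₛ (ℕP.m≤m*n n 3))) ⟩
    Base5.poch (n *ₙ 3) 1ₛ
  ≈⟨ ≗⇒≈ (≗-sym (poch₁₅-jacobi₁₅ n 1ₛ)) ⟩
    Base15.poch n (Base15.jacobi n 1ₛ)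
  ≈⟨ Truncated15.poch-jacobi n 1ₛ ⟩
    Base15.theta n 1ₛ
  ∎
  where
  open SetoidReasoning (≈-setoid (suc n))

module Pentagonal = TripleProduct 1 2

e⁻₁₅≡5P₅ : ∀ k → Base15.e⁻ k ≡ 5 *ₙ P 5 k
e⁻₁₅≡5P₅ k = trans (scale k) (cong (5 *ₙ_) (Pentagonal.e⁻≡P 5 refl refl k))
  where
  scale : ∀ k → Base15.e⁻ k ≡ 5 *ₙ Pentagonal.e⁻ k
  scale zero = refl
  scale (suc k) = trans (cong (λ t → t +ₙ 15 *ₙ k +ₙ 5) (scale k)) (lemma k (Pentagonal.e⁻ k))
    where
    lemma : ∀ k x → 5 *ₙ x +ₙ 15 *ₙ k +ₙ 5 ≡ 5 *ₙ (x +ₙ 3 *ₙ k +ₙ 1)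
    lemma = ℕSolver.solve-∀

e⁺₁₅≡5Q₅ : ∀ k → Base15.e⁺ k ≡ 5 *ₙ Q 5 k
e⁺₁₅≡5Q₅ k = trans (scale k) (cong (5 *ₙ_) (Pentagonal.e⁺≡Q 5 refl refl k))
  where
  scale : ∀ k → Base15.e⁺ k ≡ 5 *ₙ Pentagonal.e⁺ k
  scale zero = refl
  scale (suc k) = trans (cong (λ t → t +ₙ 15 *ₙ k +ₙ 10) (scale k)) (lemma k (Pentagonal.e⁺ k))
    where
    lemma : ∀ k x → 5 *ₙ x +ₙ 15 *ₙ k +ₙ 10 ≡ 5 *ₙ (x +ₙ 3 *ₙ k +ₙ 2)
    lemma = ℕSolver.solve-∀

increasing-< : ∀ (e : ℕ → ℕ) → (∀ k → e k < e (suc k)) → ∀ a b → a < b → e a < e b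
increasing-< e step a (suc b) (s≤s a≤b) with ℕP.m≤n⇒m<n∨m≡n a≤b
... | inj₁ a<b = ℕP.<-trans (increasing-< e step a b a<b) (step b)
... | inj₂ refl = step a

increasing-≤ : ∀ (e : ℕ → ℕ) → (∀ k → e k < e (suc k)) → ∀ a b → a ≤ b → e a ≤ e b
increasing-≤ e step a b a≤b with ℕP.m≤n⇒m<n∨m≡n a≤b
... | inj₁ a<b = ℕP.<⇒≤ (increasing-< e step a b a<b)
... | inj₂ refl = ℕP.≤-refl

increasing-injective : ∀ (e : ℕ → ℕ) → (∀ k → e k < e (suc k)) → ∀ a b → e a ≡ e b → a ≡ b
increasing-injective e step a b ea≡eb with ℕP.<-cmp a b
... | tri< a<b _ _ = ⊥-elim (ℕP.<-irrefl ea≡eb (increasing-< e step a b a<b))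
... | tri≈ _ a≡b _ = a≡b
... | tri> _ _ b<a = ⊥-elim (ℕP.<-irrefl (sym ea≡eb) (increasing-< e step b a b<a))

module _ where
  open Base15

  e⁻-step : ∀ k → e⁻ k < e⁻ (suc k)
  e⁻-step k = ℕP.≤-<-trans (ℕP.m≤m+n (e⁻ k) (A *ₙ k)) (ℕP.m<m+n _ (s≤s z≤n))

  e⁺-step : ∀ k → e⁺ k < e⁺ (suc k)
  e⁺-step k = ℕP.≤-<-trans (ℕP.m≤m+n (e⁺ k) (A *ₙ k)) (ℕP.m<m+n _ (s≤s z≤n))

  e⁺≡e⁻+ : ∀ k → e⁺ k ≡ e⁻ k +ₙ 5 *ₙ k
  e⁺≡e⁻+ zero = refl
  e⁺≡e⁻+ (suc k) = trans (cong (λ t → t +ₙ 15 *ₙ k +ₙ 10) (e⁺≡e⁻+ k)) (lemma k (e⁻ k))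
    where
    lemma : ∀ k x → x +ₙ 5 *ₙ k +ₙ 15 *ₙ k +ₙ 10 ≡ x +ₙ 15 *ₙ k +ₙ 5 +ₙ 5 *ₙ suc k
    lemma = ℕSolver.solve-∀

  e⁻-suc≡e⁺+ : ∀ a → e⁻ (suc a) ≡ e⁺ a +ₙ suc (10 *ₙ a +ₙ 4)
  e⁻-suc≡e⁺+ a = trans (lemma a (e⁻ a)) (cong (_+ₙ suc (10 *ₙ a +ₙ 4)) (sym (e⁺≡e⁻+ a)))
    where
    lemma : ∀ a x → x +ₙ 15 *ₙ a +ₙ 5 ≡ x +ₙ 5 *ₙ a +ₙ suc (10 *ₙ a +ₙ 4)
    lemma = ℕSolver.solve-∀

  -- e⁻ a < e⁺ a < e⁻ (a + 1) for a > 0.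
  e⁺≢e⁻ : ∀ a b → 0 < a → e⁺ a ≢ e⁻ b
  e⁺≢e⁻ a b a>0 e⁺a≡e⁻b with ℕP.≤-<-connex b a
  ... | inj₁ b≤a = ℕP.<-irrefl (sym e⁺a≡e⁻b) (ℕP.≤-<-trans (increasing-≤ e⁻ e⁻-step b a b≤a) e⁻a<e⁺a)
    where
    e⁻a<e⁺a : e⁻ a < e⁺ a
    e⁻a<e⁺a = subst (e⁻ a <_) (sym (e⁺≡e⁻+ a)) (ℕP.m<m+n (e⁻ a) (ℕP.*-mono-≤ {1} {5} (s≤s z≤n) a>0))
  ... | inj₂ a<b = ℕP.<-irrefl e⁺a≡e⁻b (ℕP.<-≤-trans e⁺a<e⁻[1+a] (increasing-≤ e⁻ e⁻-step (suc a) b a<b))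
    where
    e⁺a<e⁻[1+a] : e⁺ a < e⁻ (suc a)
    e⁺a<e⁻[1+a] = subst (e⁺ a <_) (sym (e⁻-suc≡e⁺+ a)) (ℕP.m<m+n (e⁺ a) (s≤s z≤n))

  shift-1ₛ-≡ : ∀ e → shift e 1ₛ e ≡ + 1
  shift-1ₛ-≡ e = subst (λ t → shift e 1ₛ t ≡ + 1) (ℕP.+-identityʳ e) (shift-+ e 1ₛ 0)

  shift-1ₛ-≢ : ∀ e N → N ≢ e → shift e 1ₛ N ≡ + 0
  shift-1ₛ-≢ e N N≢e with <⊎+ e N
  ... | inj₁ N<e = shift-below e 1ₛ N N<e
  ... | inj₂ (zero , refl) = ⊥-elim (N≢e (ℕP.+-identityʳ e))
  ... | inj₂ (suc N′ , refl) = shift-+ e 1ₛ (suc N′)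

  thetaTerm-miss : ∀ k N → N ≢ e⁻ k → N ≢ e⁺ k → thetaTerm k 1ₛ N ≡ + 0
  thetaTerm-miss zero zero N≢0 _ = ⊥-elim (N≢0 refl)
  thetaTerm-miss zero (suc N) _ _ = refl
  thetaTerm-miss (suc k) N N≢e⁻ N≢e⁺ = cong₂ _+_ (shift-1ₛ-≢ (e⁻ (suc k)) N N≢e⁻) (shift-1ₛ-≢ (e⁺ (suc k)) N N≢e⁺)

  thetaTerm-hit : ∀ m N → N ≡ e⁻ m ⊎ N ≡ e⁺ m → thetaTerm m 1ₛ N ≡ + 1
  thetaTerm-hit zero N (inj₁ refl) = refl
  thetaTerm-hit zero N (inj₂ refl) = refl
  thetaTerm-hit (suc m) N (inj₁ refl) =
    cong₂ _+_ (shift-1ₛ-≡ (e⁻ (suc m))) (shift-1ₛ-≢ (e⁺ (suc m)) _ (λ e → e⁺≢e⁻ (suc m) (suc m) (s≤s z≤n) (sym e)))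
  thetaTerm-hit (suc m) N (inj₂ refl) =
    cong₂ _+_ (shift-1ₛ-≢ (e⁻ (suc m)) _ (e⁺≢e⁻ (suc m) (suc m) (s≤s z≤n))) (shift-1ₛ-≡ (e⁺ (suc m)))

  exponents-distinct : ∀ m k N → k ≢ m → N ≡ e⁻ m ⊎ N ≡ e⁺ m → N ≢ e⁻ k × N ≢ e⁺ k
  exponents-distinct m k N k≢m (inj₁ refl) =
    (λ e → k≢m (increasing-injective e⁻ e⁻-step k m (sym e))) , e⁻≢e⁺ k k≢m
    where
    e⁻≢e⁺ : ∀ k → k ≢ m → e⁻ m ≢ e⁺ k
    e⁻≢e⁺ zero 0≢m e = 0≢m (increasing-injective e⁻ e⁻-step 0 m (sym e))
    e⁻≢e⁺ (suc k) _ e = e⁺≢e⁻ (suc k) m (s≤s z≤n) (sym e)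
  exponents-distinct zero k N k≢0 (inj₂ refl) = exponents-distinct zero k N k≢0 (inj₁ refl)
  exponents-distinct (suc m) k N k≢m (inj₂ refl) =
    (λ e → e⁺≢e⁻ (suc m) k (s≤s z≤n) e) , (λ e → k≢m (increasing-injective e⁺ e⁺-step k (suc m) (sym e)))

-1^≡alt : ∀ k → -1ℤ ^ℤ k ≡ alt k
-1^≡alt zero = refl
-1^≡alt (suc k) = trans (cong (-1ℤ *_) (-1^≡alt k)) (ℤP.-1*i≡-i (alt k))

theta₁₅-value : ∀ n M → IsM n M → Base15.theta n 1ₛ n ≡ M
theta₁₅-value n M (inj₂ (none , refl)) =
  sumℤ-zero n _ (λ k _ → trans (cong (alt k *_) (miss k)) (ℤP.*-zeroʳ (alt k)))
  where
  miss : ∀ k → Base15.thetaTerm k 1ₛ n ≡ + 0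
  miss k = thetaTerm-miss k n (λ e → proj₁ (none k) (trans e (e⁻₁₅≡5P₅ k)))
                              (λ e → proj₂ (none k) (trans e (e⁺₁₅≡5Q₅ k)))
theta₁₅-value n M (inj₁ (m , n≡ , refl)) =
  trans (sumℤ-single n m _ m≤n others)
    (trans (cong (alt m *_) (thetaTerm-hit m n hit)) (trans (ℤP.*-identityʳ (alt m)) (sym (-1^≡alt m))))
  where
  exponent-form : n ≡ 5 *ₙ P 5 m ⊎ n ≡ 5 *ₙ Q 5 m → n ≡ Base15.e⁻ m ⊎ n ≡ Base15.e⁺ m
  exponent-form (inj₁ n≡5P) = inj₁ (trans n≡5P (sym (e⁻₁₅≡5P₅ m)))
  exponent-form (inj₂ n≡5Q) = inj₂ (trans n≡5Q (sym (e⁺₁₅≡5Q₅ m)))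
  hit : n ≡ Base15.e⁻ m ⊎ n ≡ Base15.e⁺ m
  hit = exponent-form n≡
  m≤exponent : n ≡ Base15.e⁻ m ⊎ n ≡ Base15.e⁺ m → m ≤ n
  m≤exponent (inj₁ refl) = Truncated15.e⁻-≥ m
  m≤exponent (inj₂ refl) = Truncated15.e⁺-≥ m
  m≤n : m ≤ n
  m≤n = m≤exponent hit
  others : ∀ k → k ≢ m → alt k * Base15.thetaTerm k 1ₛ n ≡ + 0
  others k k≢m =
    let (n≢e⁻ , n≢e⁺) = exponents-distinct m k n k≢m hit
    in trans (cong (alt k *_) (thetaTerm-miss k n n≢e⁻ n≢e⁺)) (ℤP.*-zeroʳ (alt k))

shift-p14Series : ∀ e n → shift e p14Series n ≡ p14ℤ (+ n - + e)
shift-p14Series e n with <⊎+ e n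
... | inj₁ n<e with split≤ n<e
...   | (k , refl) =
  trans (shift-below (suc n +ₙ k) p14Series n n<e)
    (sym (cong p14ℤ (trans (ℤP.m-n≡m⊖n n (suc n +ₙ k)) (trans (ℤP.⊖-< n<e) (cong (λ t → - (+ t)) gap)))))
  where
  gap : suc n +ₙ k ∸ₙ n ≡ suc k
  gap = trans (ℕP.+-∸-assoc 1 (ℕP.m≤m+n n k)) (cong suc (ℕP.m+n∸m≡n n k))
shift-p14Series e n | inj₂ (n′ , refl) =
  trans (shift-+ e p14Series n′)
    (sym (cong p14ℤ (trans (ℤP.m-n≡m⊖n (e +ₙ n′) e) (trans (ℤP.⊖-≥ (ℕP.m≤m+n e n′)) (cong +_ (ℕP.m+n∸m≡n e n′))))))

sumℤ1-term : ∀ K n → sumℤ1 K (term n) ≡ p14Series n - Base5.theta K p14Series n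
sumℤ1-term zero n = sym (trans (cong (λ t → p14Series n - t) (ℤP.*-identityˡ (p14Series n))) (ℤP.+-inverseʳ (p14Series n)))
sumℤ1-term (suc K) n =
  trans (cong₂ _+_ (sumℤ1-term K n) term≡)
    (rearrange (p14Series n) (Base5.theta K p14Series n) (alt (suc K)) (Base5.thetaTerm (suc K) p14Series n))
  where
  term≡ : term n (suc K) ≡ - alt (suc K) * Base5.thetaTerm (suc K) p14Series n
  term≡ = cong₂ _*_ (trans (-1^≡alt (suc K +ₙ 1)) (cong alt (ℕP.+-comm (suc K) 1)))
            (cong₂ _+_ (trans (cong (λ t → p14ℤ (+ n - + t)) (sym (Base5.e⁻≡P 7 refl refl (suc K))))
                              (sym (shift-p14Series (Base5.e⁻ (suc K)) n)))
                       (trans (cong (λ t → p14ℤ (+ n - + t)) (sym (Base5.e⁺≡Q 7 refl refl (suc K))))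
                              (sym (shift-p14Series (Base5.e⁺ (suc K)) n))))
  rearrange : ∀ (a t s x : ℤ) → (a - t) + (- s) * x ≡ a - (t + s * x)
  rearrange = solve-∀

theorem3 : (n K : ℕ) → n ≤ K → (M : ℤ) → IsM n M →
    + p14 n ≡ M +ℤ sumℤ1 K (term n)
theorem3 n K n≤K M isM with split≤ n≤K
... | (d , refl) =
  begin
    + p14 n                                          ≡⟨ split (+ p14 n) M ⟩
    M + (p14Series n - M)                            ≡⟨ cong (λ t → M + (p14Series n - t)) (sym theta-at-n) ⟩
    M + (p14Series n - Base5.theta (n +ₙ d) p14Series n) ≡⟨ cong (λ t → M + t) (sym (sumℤ1-term (n +ₙ d) n)) ⟩
    M + sumℤ1 (n +ₙ d) (term n)                      ∎
  where
  open ≡-Reasoning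
  split : ∀ (a M : ℤ) → a ≡ M + (a - M)
  split = solve-∀
  theta-at-n : Base5.theta (n +ₙ d) p14Series n ≡ M
  theta-at-n = trans (Truncated5.theta-stable n d p14Series n ℕP.≤-refl)
                 (trans (theta₅-p14≈theta₁₅ n n ℕP.≤-refl) (theta₁₅-value n M isM))
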